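{- Let $U$ be any subset of $W_n$ and let $\Delta$ be the $\mathbb{Z}[v,v^{ -1}]$-submodule of $\mathcal{H}$ spanned by $\{C_x\mid x\in U\}$. Then the images of $\{T_w\mid w\in W_n\setminus U\}$ form a $\mathbb{Z}[v,v^{ -1}]$-basis of $\mathcal{H}/\Delta$. The corresponding statement holds over any unital commutative ring $\Bbbk$ upon specialization $v\mapsto 1$: the images of $\{w \mid w\in W_n\setminus U\}$ form a $\Bbbk$-basis of $\Bbbk[W_n]/\Delta_\Bbbk$, where $\Delta_\Bbbk$ is the $\Bbbk$-span of the specialized elements $C_x$, $x\in U$.
   Context: $W_n$ is the symmetric group on $\{1,\dots,n\}$, $S$ its set of adjacent transpositions, $l$ the length function. $\mathcal{H}$ is the Iwahori--Hecke algebra over $\mathbb{Z}[v,v^{ -1}]$ with basis $\{T_w\}$, $T_1=1$, $T_sT_w=T_{sw}$ if $l(sw)=l(w)+1$, $T_sT_w=T_{sw}+(v-v^{ -1})T_w$ if $l(sw)=l(w)-1$. The bar involution is the ring involution with $\overline{\sum a_wT_w}=\sum\overline{a_w}T_{w^{ -1}}^{ -1}$, $\overline{v}=v^{ -1}$. $C_w$ is the unique bar-invariant element with $C_w\equiv T_w$ modulo $\sum_y v\mathbb{Z}[v]T_y$ (the Kazhdan--Lusztig basis). Specialization $v\mapsto 1$ means tensoring with $\Bbbk$ via $v^{\pm1}\mapsto 1$, which identifies $\Bbbk\otimes\mathcal{H}$ with $\Bbbk[W_n]$ via $T_w\mapsto w$. -}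

module Defs where

open import Level using (Level)
open import Data.Bool using (Bool; true; false; T; not; _∧_; _∨_; if_then_else_)
open import Data.Nat as ℕ using (ℕ; zero; suc; _<ᵇ_; _<_; _<?_)
open import Data.Integer as ℤ using (ℤ; +_; -[1+_]; 0ℤ; 1ℤ)
open import Data.Fin using (Fin; toℕ; fromℕ<)
open import Data.Fin.Properties using () renaming (_≟_ to _≟F_)
open import Data.Fin.Permutation using (transpose; _⟨$⟩ʳ_; _⟨$⟩ˡ_; inverseˡ)
open import Data.List using (List; []; _∷_; _++_; map; concatMap; mapMaybe; allFin)
open import Data.List.Relation.Unary.All using (All)
open import Data.Vec as Vec using (Vec; toList)
open import Data.Vec.Properties using (≡-dec; toList-map)
open import Data.Maybe using (Maybe; just; nothing)
open import Data.Product using (Σ; _×_; _,_; proj₁; proj₂; ∃-syntax)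
open import Relation.Nullary using (does; yes; no)
open import Relation.Binary.PropositionalEquality using (_≡_; refl; cong; cong₂; subst; sym; trans)
open import Algebra.Bundles using (CommutativeRing)

-- Laurent polynomials  Z[v,v⁻¹]
-- An element is a formal finite sum of monomials  c·v^e, given as a
-- list of pairs (e , c).

L : Set
L = List (ℤ × ℤ)

coeffL : L → ℤ → ℤ
coeffL []              k = 0ℤ
coeffL ((e , c) ∷ p)   k = (if does (e ℤ.≟ k) then c else 0ℤ) ℤ.+ coeffL p k

_≈L_ : L → L → Set
p ≈L q = ∀ k → coeffL p k ≡ coeffL q k

0L 1L vL v⁻¹L : L
0L   = []
1L   = (0ℤ , 1ℤ) ∷ []
vL   = (1ℤ , 1ℤ) ∷ []
v⁻¹L = (ℤ.- 1ℤ , 1ℤ) ∷ []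

_+L_ : L → L → L
_+L_ = _++_

_*L_ : L → L → L
p *L q = concatMap (λ m → map (λ m′ → (proj₁ m ℤ.+ proj₁ m′ , proj₂ m ℤ.* proj₂ m′)) q) p

-L_ : L → L
-L p = map (λ m → (proj₁ m , ℤ.- proj₂ m)) p

barL : L → L
barL p = map (λ m → (ℤ.- proj₁ m , proj₂ m)) p

InVZv : L → Set
InVZv p = ∀ k → k ℤ.≤ 0ℤ → coeffL p k ≡ 0ℤ

ev1 : L → ℤ
ev1 []            = 0ℤ
ev1 ((e , c) ∷ p) = c ℤ.+ ev1 p

-- The symmetric group W_n, in one-line notation:
-- w is the vector (w(0), …, w(n-1)) of pairwise distinct entries.

anyEq : ∀ {n} → Fin n → List (Fin n) → Bool
anyEq x []       = false
anyEq x (y ∷ ys) = does (x ≟F y) ∨ anyEq x ys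

allDistinct : ∀ {n} → List (Fin n) → Bool
allDistinct []       = true
allDistinct (x ∷ xs) = not (anyEq x xs) ∧ allDistinct xs

isPerm : ∀ {n} → Vec (Fin n) n → Bool
isPerm v = allDistinct (toList v)

W : ℕ → Set
W n = Σ (Vec (Fin n) n) (λ v → T (isPerm v))

_==W_ : ∀ {n} → W n → W n → Bool
x ==W y = does (≡-dec _≟F_ (proj₁ x) (proj₁ y))

countLess : ∀ {n} → Fin n → List (Fin n) → ℕ
countLess x []       = 0
countLess x (y ∷ ys) = (if toℕ y <ᵇ toℕ x then 1 else 0) ℕ.+ countLess x ys

inversions : ∀ {n} → List (Fin n) → ℕ
inversions []       = 0
inversions (x ∷ xs) = countLess x xs ℕ.+ inversions xs

len : ∀ {n} → W n → ℕ
len w = inversions (toList (proj₁ w))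

S : ℕ → Set
S n = Σ (Fin n) (λ i → suc (toℕ i) < n)

allS : ∀ n → List (S n)
allS n = mapMaybe f (allFin n)
  where
  f : Fin n → Maybe (S n)
  f i with suc (toℕ i) <? n
  ... | yes p = just (i , p)
  ... | no _  = nothing

sFun : ∀ {n} → S n → Fin n → Fin n
sFun (i , p) k = transpose i (fromℕ< p) ⟨$⟩ʳ k

private
  sFun-inj : ∀ {n} (s : S n) {a b} → sFun s a ≡ sFun s b → a ≡ b
  sFun-inj (i , p) {a} {b} e =
    trans (sym (inverseˡ (transpose i (fromℕ< p))))
      (trans (cong (transpose i (fromℕ< p) ⟨$⟩ˡ_) e) (inverseˡ (transpose i (fromℕ< p))))

  anyEq-map : ∀ {n} (f : Fin n → Fin n) → (∀ {a b} → f a ≡ f b → a ≡ b) →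
              ∀ x ys → anyEq (f x) (map f ys) ≡ anyEq x ys
  anyEq-map f inj x []       = refl
  anyEq-map f inj x (y ∷ ys) with x ≟F y | f x ≟F f y
  ... | yes _  | yes _  = refl
  ... | no _   | no _   = anyEq-map f inj x ys
  ... | yes e  | no ne  with ne (cong f e)
  ... | ()
  anyEq-map f inj x (y ∷ ys) | no ne | yes e with ne (inj e)
  ... | ()

  allDistinct-map : ∀ {n} (f : Fin n → Fin n) → (∀ {a b} → f a ≡ f b → a ≡ b) →
                    ∀ xs → allDistinct (map f xs) ≡ allDistinct xs
  allDistinct-map f inj []       = refl
  allDistinct-map f inj (x ∷ xs) =
    cong₂ (λ a b → not a ∧ b) (anyEq-map f inj x xs) (allDistinct-map f inj xs)

-- left multiplication  w ↦ s w   (i.e. (s w)(k) = s(w(k)))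
act : ∀ {n} → S n → W n → W n
act s (v , pf) = Vec.map (sFun s) v ,
  subst T (sym (trans (cong allDistinct (toList-map (sFun s) v))
                      (allDistinct-map (sFun s) (sFun-inj s) (toList v)))) pf

descent : ∀ {n} → W n → Maybe (S n)
descent {n} w = go (allS n)
  where
  go : List (S n) → Maybe (S n)
  go []       = nothing
  go (s ∷ ss) = if len (act s w) <ᵇ len w then just s else go ss

-- The Hecke algebra H as the free Z[v,v⁻¹]-module on {T_w}.
-- An element is a formal finite sum  Σ a_i T_{w_i}, a list of pairs.

H : ℕ → Set
H n = List (L × W n)

coeffH : ∀ {n} → H n → W n → L
coeffH []            w = 0L
coeffH ((a , x) ∷ h) w = (if x ==W w then a else 0L) +L coeffH h w

_≈H_ : ∀ {n} → H n → H n → Set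
h ≈H h′ = ∀ w → coeffH h w ≈L coeffH h′ w

Tb : ∀ {n} → W n → H n
Tb w = (1L , w) ∷ []

_•H_ : ∀ {n} → L → H n → H n
a •H h = map (λ t → (a *L proj₁ t , proj₂ t)) h

-H_ : ∀ {n} → H n → H n
-H h = (-L 1L) •H h

-- left multiplication by T_s:
--   T_s T_w = T_{sw}                     if l(sw) = l(w)+1
--   T_s T_w = T_{sw} + (v - v⁻¹) T_w     if l(sw) = l(w)-1
TsMul : ∀ {n} → S n → H n → H n
TsMul s = concatMap step
  where
  step : _ → _
  step (a , w) = if len w <ᵇ len (act s w)
                 then (a , act s w) ∷ []
                 else (a , act s w) ∷ (a *L (vL +L (-L v⁻¹L)) , w) ∷ []

-- left multiplication by T_s⁻¹ = T_s - (v - v⁻¹)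
TsInvMul : ∀ {n} → S n → H n → H n
TsInvMul s h = TsMul s h ++ ((-L (vL +L (-L v⁻¹L))) •H h)

-- bar(T_w) = T_{w⁻¹}⁻¹ = T_{s_1}⁻¹ ⋯ T_{s_k}⁻¹ for a reduced word
-- w = s_1 ⋯ s_k, computed by peeling off left descents
-- (the fuel l(w) suffices since each step lowers the length by one).
barT′ : ∀ {n} → ℕ → W n → H n
barT′ zero    w = Tb w
barT′ (suc k) w with descent w
... | nothing = Tb w
... | just s  = TsInvMul s (barT′ k (act s w))

barT : ∀ {n} → W n → H n
barT w = barT′ (len w) w

barH : ∀ {n} → H n → H n
barH h = concatMap (λ t → barL (proj₁ t) •H barT (proj₂ t)) h

IsKLBasis : ∀ {n} → (W n → H n) → Set
IsKLBasis {n} C =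
  (∀ x → barH (C x) ≈H C x) ×
  (∀ x y → InVZv (coeffH (C x ++ (-H Tb x)) y))

combC : ∀ {n} → (W n → H n) → List (L × W n) → H n
combC C bs = concatMap (λ t → proj₁ t •H C (proj₂ t)) bs

QuotBasis : ∀ {n} → (W n → Bool) → (W n → H n) → Set
QuotBasis {n} U C =
  (∀ (h : H n) → ∃[ as ] ∃[ bs ]
      All (λ t → U (proj₂ t) ≡ false) as ×
      All (λ t → U (proj₂ t) ≡ true) bs ×
      (h ≈H (as ++ combC C bs))) ×
  (∀ (as bs : List (L × W n)) →
      All (λ t → U (proj₂ t) ≡ false) as →
      All (λ t → U (proj₂ t) ≡ true) bs →
      as ≈H combC C bs →
      ∀ w → coeffH as w ≈L 0L)

-- Specialization v ↦ 1 over a commutative ring k:  k ⊗ H ≅ k[W_n],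
-- T_w ↦ w, a ↦ image of a(1) under the canonical map Z → k.

module Spec {c ℓ : Level} (R : CommutativeRing c ℓ) where
  open CommutativeRing R

  natK : ℕ → Carrier
  natK zero    = 0#
  natK (suc m) = 1# + natK m

  intK : ℤ → Carrier
  intK (+ m)    = natK m
  intK -[1+ m ] = - natK (suc m)

  KW : ℕ → Set c
  KW n = List (Carrier × W n)

  coeffK : ∀ {n} → KW n → W n → Carrier
  coeffK []            w = 0#
  coeffK ((a , x) ∷ h) w = (if x ==W w then a else 0#) + coeffK h w

  _≈K_ : ∀ {n} → KW n → KW n → Set ℓ
  h ≈K h′ = ∀ w → coeffK h w ≈ coeffK h′ w

  _•K_ : ∀ {n} → Carrier → KW n → KW n
  a •K h = map (λ t → (a * proj₁ t , proj₂ t)) h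

  spec : ∀ {n} → H n → KW n
  spec h = map (λ t → (intK (ev1 (proj₁ t)) , proj₂ t)) h

  combCK : ∀ {n} → (W n → H n) → List (Carrier × W n) → KW n
  combCK C bs = concatMap (λ t → proj₁ t •K spec (C (proj₂ t))) bs

  QuotBasisK : ∀ {n} → (W n → Bool) → (W n → H n) → Set (c Level.⊔ ℓ)
  QuotBasisK {n} U C =
    (∀ (h : KW n) → ∃[ as ] ∃[ bs ]
        All (λ t → U (proj₂ t) ≡ false) as ×
        All (λ t → U (proj₂ t) ≡ true) bs ×
        (h ≈K (as ++ combCK C bs))) ×
    (∀ (as bs : List (Carrier × W n)) →
        All (λ t → U (proj₂ t) ≡ false) as →
        All (λ t → U (proj₂ t) ≡ true) bs →
        as ≈K combCK C bs →
        ∀ w → coeffK as w ≈ 0#)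

{-# OPTIONS --safe #-}
-- Bar-invariance and C_x ≡ T_x mod vℤ[v] force C_x = T_x + Σ_{l(y)<l(x)} p_{y,x} T_y:
-- going down in l(y), once the coefficients of C_x at longer elements vanish, its
-- coefficient at y is bar-invariant (bar T_w is T_w plus shorter terms), so its
-- difference from that of T_x is a bar-invariant element of vℤ[v] and hence zero.
-- A family that is unitriangular for a length function gives a basis of the quotient:
-- T_x for x ∈ U is C_x minus lower terms (spanning), and in a relation
-- Σ_{w∉U} a_w T_w = Σ_{x∈U} b_x C_x the coefficient b_x of a longest x must vanish
-- (independence).  Unitriangularity survives v ↦ 1, so the same argument works over
-- any commutative ring.
module Submission where

open import Defs
open import Level using (Level)
open import Algebra.Bundles using (Ring; CommutativeRing)
open import Data.Bool using (Bool; if_then_else_)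
open import Data.List using (List; []; _∷_)
open import Data.Nat using (ℕ)
open import Data.Product using (_×_; _,_)
open import Relation.Binary.Definitions using (DecidableEquality)
open import Relation.Nullary using (does)

module MeasureInduction where

  open import Data.Nat using (_≤_; _<_; _∸_)
  open import Data.Nat.Properties using (∸-monoʳ-<)
  open import Data.Nat.Induction using (<-wellFounded)
  open import Induction.WellFounded using (module All)
  import Relation.Binary.Construct.On as On

  module _ {p} {A : Set} (μ : A → ℕ) (P : A → Set p) where

    upward-induction : (∀ x → (∀ y → μ y < μ x → P y) → P x) → ∀ x → P x
    upward-induction step =
      All.wfRec (On.wellFounded μ <-wellFounded) p P (λ x ih → step x (λ y → ih))

    downward-induction : ∀ {B} → (∀ x → μ x ≤ B) →
      (∀ x → (∀ y → μ x < μ y → P y) → P x) → ∀ x → P x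
    downward-induction {B} μ≤B step =
      All.wfRec (On.wellFounded (λ x → B ∸ μ x) <-wellFounded) p P
        (λ x ih → step x (λ y μx<μy → ih (∸-monoʳ-< μx<μy (μ≤B y))))

-- The coefficient function is a parameter so that coeffH, coeffK and coeffL from Defs
-- are instances on the nose.
module FormalSum
  {c ℓ} (K : Ring c ℓ) {A : Set} (_≟_ : DecidableEquality A)
  (coeff : List (Ring.Carrier K × A) → A → Ring.Carrier K)
  (coeff-[] : ∀ w → Ring._≈_ K (coeff [] w) (Ring.0# K))
  (coeff-∷ : ∀ a x h w → Ring._≈_ K (coeff ((a , x) ∷ h) w)
                                     (Ring._+_ K (if does (x ≟ w) then a else Ring.0# K) (coeff h w)))
  where

  import Level
  open import Data.Bool using (true; false)
  open import Data.List using (_++_; map; concatMap; filter)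
  open import Data.Nat using (_≤_; _<_; _<?_; _≤?_)
  open import Data.Nat.Properties using (≮⇒≥; ≰⇒>; <⇒≢)
  open import Data.Bool.Properties using (not-¬)
  open import Data.List.Properties using (filter-accept; filter-reject)
  open import Data.List.Relation.Unary.All using (All; []; _∷_; universal)
  import Data.List.Relation.Unary.All as All
  open import Data.List.Relation.Unary.All.Properties using (++⁺; map⁺; all-filter)
  open import Data.Product using (proj₁; proj₂; ∃-syntax)
  open import Data.Sum using (_⊎_; inj₁; inj₂)
  open import Function using (_∘_)
  open import Relation.Binary.PropositionalEquality as ≡ using (_≡_; _≢_)
  open import Relation.Nullary using (¬_; yes; no; Dec)
  open import Relation.Nullary.Decidable using (dec-true; dec-false)
  open import Relation.Unary using (Pred; Decidable)

  open Ring K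
  open import Algebra.Properties.Ring K using (-1*x≈-x; -0#≈0#)
  open import Algebra.Properties.Group +-group using (x∙y⁻¹≈ε⇒x≈y)
  open import Algebra.Properties.CommutativeSemigroup +-commutativeSemigroup
    using (interchange; x∙yz≈y∙xz)
  open import Relation.Binary.Reasoning.Setoid setoid
  open MeasureInduction

  Sum : Set c
  Sum = List (Carrier × A)

  _•_ : Carrier → Sum → Sum
  a • h = map (λ t → (a * proj₁ t , proj₂ t)) h

  combination : (A → Sum) → Sum → Sum
  combination D bs = concatMap (λ t → proj₁ t • D (proj₂ t)) bs

  ⟨_,_⟩ : Sum → (A → Carrier) → Carrier
  ⟨ [] , f ⟩ = 0#
  ⟨ (a , x) ∷ h , f ⟩ = a * f x + ⟨ h , f ⟩

  T : A → Sum
  T x = (1# , x) ∷ []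

  δ : A → A → Carrier
  δ x y = if does (x ≟ y) then 1# else 0#

  _without_ : (A → Carrier) → A → A → Carrier
  (f without x) y = if does (y ≟ x) then 0# else f y

  module _ {b} {B : Set b} (F : Bool → B) where

    on-diagonal : ∀ x → F (does (x ≟ x)) ≡ F true
    on-diagonal x = ≡.cong F (dec-true (x ≟ x) ≡.refl)

    off-diagonal : ∀ {x y} → x ≢ y → F (does (x ≟ y)) ≡ F false
    off-diagonal {x} {y} x≢y = ≡.cong F (dec-false (x ≟ y) x≢y)

  ⟨⟩-congʳ : ∀ h {f g} → (∀ x → f x ≈ g x) → ⟨ h , f ⟩ ≈ ⟨ h , g ⟩
  ⟨⟩-congʳ [] f≈g = refl
  ⟨⟩-congʳ ((a , x) ∷ h) f≈g = +-cong (*-congˡ (f≈g x)) (⟨⟩-congʳ h f≈g)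

  ⟨⟩-++ : ∀ h h′ f → ⟨ h ++ h′ , f ⟩ ≈ ⟨ h , f ⟩ + ⟨ h′ , f ⟩
  ⟨⟩-++ [] h′ f = sym (+-identityˡ _)
  ⟨⟩-++ ((a , x) ∷ h) h′ f = trans (+-congˡ (⟨⟩-++ h h′ f)) (sym (+-assoc _ _ _))

  ⟨⟩-• : ∀ a h f → ⟨ a • h , f ⟩ ≈ a * ⟨ h , f ⟩
  ⟨⟩-• a [] f = sym (zeroʳ a)
  ⟨⟩-• a ((b , x) ∷ h) f =
    trans (+-cong (*-assoc a b (f x)) (⟨⟩-• a h f)) (sym (distribˡ a _ _))

  ⟨⟩-+ : ∀ h f g → ⟨ h , (λ x → f x + g x) ⟩ ≈ ⟨ h , f ⟩ + ⟨ h , g ⟩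
  ⟨⟩-+ [] f g = sym (+-identityˡ 0#)
  ⟨⟩-+ ((a , x) ∷ h) f g =
    trans (+-cong (distribˡ a (f x) (g x)) (⟨⟩-+ h f g)) (interchange _ _ _ _)

  ⟨⟩-*ʳ : ∀ h f r → ⟨ h , (λ x → f x * r) ⟩ ≈ ⟨ h , f ⟩ * r
  ⟨⟩-*ʳ [] f r = sym (zeroˡ r)
  ⟨⟩-*ʳ ((a , x) ∷ h) f r =
    trans (+-cong (sym (*-assoc a (f x) r)) (⟨⟩-*ʳ h f r)) (sym (distribʳ r _ _))

  ⟨⟩-0 : ∀ h → ⟨ h , (λ _ → 0#) ⟩ ≈ 0#
  ⟨⟩-0 [] = refl
  ⟨⟩-0 ((a , x) ∷ h) = trans (+-cong (zeroʳ a) (⟨⟩-0 h)) (+-identityˡ 0#)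

  ⟨⟩-combination : ∀ D bs f → ⟨ combination D bs , f ⟩ ≈ ⟨ bs , (λ x → ⟨ D x , f ⟩) ⟩
  ⟨⟩-combination D [] f = refl
  ⟨⟩-combination D ((b , x) ∷ bs) f =
    trans (⟨⟩-++ (b • D x) (combination D bs) f)
          (+-cong (⟨⟩-• b (D x) f) (⟨⟩-combination D bs f))

  δ-≢ : ∀ {x y} → x ≢ y → δ x y ≈ 0#
  δ-≢ x≢y = reflexive (off-diagonal (λ b → if b then 1# else 0#) x≢y)

  δ-transport : ∀ x y (f : A → Carrier) → δ x y * f y ≈ δ x y * f x
  δ-transport x y f = by-cases (x ≟ y)
    where
    by-cases : Dec (x ≡ y) → δ x y * f y ≈ δ x y * f x
    by-cases (yes ≡.refl) = refl
    by-cases (no x≢y) = begin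
      δ x y * f y   ≈⟨ *-congʳ (δ-≢ x≢y) ⟩
      0# * f y      ≈⟨ zeroˡ (f y) ⟩
      0#            ≈⟨ zeroˡ (f x) ⟨
      0# * f x      ≈⟨ *-congʳ (δ-≢ x≢y) ⟨
      δ x y * f x   ∎

  δ-central : ∀ x y r → δ x y * r ≈ r * δ x y
  δ-central x y r with does (x ≟ y)
  ... | true  = trans (*-identityˡ r) (sym (*-identityʳ r))
  ... | false = trans (zeroˡ r) (sym (zeroʳ r))

  coeff-as-pairing : ∀ h w → coeff h w ≈ ⟨ h , (λ x → δ x w) ⟩
  coeff-as-pairing [] w = coeff-[] w
  coeff-as-pairing ((a , x) ∷ h) w =
    trans (coeff-∷ a x h w) (+-cong (select (does (x ≟ w))) (coeff-as-pairing h w))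
    where
    select : ∀ b → (if b then a else 0#) ≈ a * (if b then 1# else 0#)
    select true  = sym (*-identityʳ a)
    select false = sym (zeroʳ a)

  coeff-++ : ∀ h h′ w → coeff (h ++ h′) w ≈ coeff h w + coeff h′ w
  coeff-++ h h′ w = begin
    coeff (h ++ h′) w                                   ≈⟨ coeff-as-pairing (h ++ h′) w ⟩
    ⟨ h ++ h′ , (λ x → δ x w) ⟩                         ≈⟨ ⟨⟩-++ h h′ _ ⟩
    ⟨ h , (λ x → δ x w) ⟩ + ⟨ h′ , (λ x → δ x w) ⟩      ≈⟨ +-cong (coeff-as-pairing h w) (coeff-as-pairing h′ w) ⟨
    coeff h w + coeff h′ w                              ∎

  coeff-• : ∀ a h w → coeff (a • h) w ≈ a * coeff h w
  coeff-• a h w = begin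
    coeff (a • h) w                ≈⟨ coeff-as-pairing (a • h) w ⟩
    ⟨ a • h , (λ x → δ x w) ⟩      ≈⟨ ⟨⟩-• a h _ ⟩
    a * ⟨ h , (λ x → δ x w) ⟩      ≈⟨ *-congˡ (coeff-as-pairing h w) ⟨
    a * coeff h w                  ∎

  coeff-combination : ∀ D bs w → coeff (combination D bs) w ≈ ⟨ bs , (λ x → coeff (D x) w) ⟩
  coeff-combination D bs w = begin
    coeff (combination D bs) w                        ≈⟨ coeff-as-pairing (combination D bs) w ⟩
    ⟨ combination D bs , (λ x → δ x w) ⟩              ≈⟨ ⟨⟩-combination D bs _ ⟩
    ⟨ bs , (λ x → ⟨ D x , (λ y → δ y w) ⟩) ⟩          ≈⟨ ⟨⟩-congʳ bs (λ x → coeff-as-pairing (D x) w) ⟨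
    ⟨ bs , (λ x → coeff (D x) w) ⟩                    ∎

  coeff-∷-≢ : ∀ a {x w} h → x ≢ w → coeff ((a , x) ∷ h) w ≈ coeff h w
  coeff-∷-≢ a {x} {w} h x≢w = begin
    coeff ((a , x) ∷ h) w                                ≈⟨ coeff-∷ a x h w ⟩
    (if does (x ≟ w) then a else 0#) + coeff h w        ≡⟨ off-diagonal (λ b → (if b then a else 0#) + coeff h w) x≢w ⟩
    0# + coeff h w                                       ≈⟨ +-identityˡ _ ⟩
    coeff h w                                            ∎

  coeff-vanishes-off : ∀ {p} {P : Pred A p} {h w} → All (P ∘ proj₂) h → ¬ P w → coeff h w ≈ 0#
  coeff-vanishes-off {h = []} {w} [] ¬Pw = coeff-[] w
  coeff-vanishes-off {h = (a , x) ∷ h} {w} (Px ∷ Ph) ¬Pw =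
    trans (coeff-∷-≢ a h (λ { ≡.refl → ¬Pw Px })) (coeff-vanishes-off Ph ¬Pw)

  module _ {p} {P : Pred A p} (P? : Decidable P) where

    coeff-filter-reject : ∀ h {w} → ¬ P w → coeff (filter (P? ∘ proj₂) h) w ≈ 0#
    coeff-filter-reject h = coeff-vanishes-off (all-filter (P? ∘ proj₂) h)

    coeff-filter-accept : ∀ h {w} → P w → coeff (filter (P? ∘ proj₂) h) w ≈ coeff h w
    coeff-filter-accept [] {w} Pw = refl
    coeff-filter-accept ((a , x) ∷ h) {w} Pw = by-cases (P? x)
      where
      by-cases : Dec (P x) → coeff (filter (P? ∘ proj₂) ((a , x) ∷ h)) w ≈ coeff ((a , x) ∷ h) w
      by-cases (yes Px) = begin
        coeff (filter (P? ∘ proj₂) ((a , x) ∷ h)) w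
          ≡⟨ ≡.cong (λ l → coeff l w) (filter-accept (P? ∘ proj₂) Px) ⟩
        coeff ((a , x) ∷ filter (P? ∘ proj₂) h) w
          ≈⟨ coeff-∷ a x _ w ⟩
        (if does (x ≟ w) then a else 0#) + coeff (filter (P? ∘ proj₂) h) w
          ≈⟨ +-congˡ (coeff-filter-accept h Pw) ⟩
        (if does (x ≟ w) then a else 0#) + coeff h w
          ≈⟨ coeff-∷ a x h w ⟨
        coeff ((a , x) ∷ h) w ∎
      by-cases (no ¬Px) = begin
        coeff (filter (P? ∘ proj₂) ((a , x) ∷ h)) w
          ≡⟨ ≡.cong (λ l → coeff l w) (filter-reject (P? ∘ proj₂) ¬Px) ⟩
        coeff (filter (P? ∘ proj₂) h) w
          ≈⟨ coeff-filter-accept h Pw ⟩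
        coeff h w
          ≈⟨ coeff-∷-≢ a h (λ { ≡.refl → ¬Px Pw }) ⟨
        coeff ((a , x) ∷ h) w ∎

  ⟨⟩-split : ∀ x h f → ⟨ h , f ⟩ ≈ coeff h x * f x + ⟨ h , f without x ⟩
  ⟨⟩-split x h f = begin
    ⟨ h , f ⟩                                                   ≈⟨ ⟨⟩-congʳ h (λ y → decompose y (y ≟ x)) ⟩
    ⟨ h , (λ y → δ y x * f x + (f without x) y) ⟩               ≈⟨ ⟨⟩-+ h _ _ ⟩
    ⟨ h , (λ y → δ y x * f x) ⟩ + ⟨ h , f without x ⟩           ≈⟨ +-congʳ (⟨⟩-*ʳ h _ (f x)) ⟩
    ⟨ h , (λ y → δ y x) ⟩ * f x + ⟨ h , f without x ⟩           ≈⟨ +-congʳ (*-congʳ (coeff-as-pairing h x)) ⟨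
    coeff h x * f x + ⟨ h , f without x ⟩                       ∎
    where
    decompose : ∀ y → Dec (y ≡ x) → f y ≈ δ y x * f x + (f without x) y
    decompose y (yes ≡.refl) = begin
      f x                                                       ≈⟨ +-identityʳ (f x) ⟨
      f x + 0#                                                  ≈⟨ +-congʳ (*-identityˡ (f x)) ⟨
      1# * f x + 0#                                             ≡⟨ on-diagonal (λ b → (if b then 1# else 0#) * f x + (if b then 0# else f x)) x ⟨
      δ x x * f x + (f without x) x                             ∎
    decompose y (no y≢x) = begin
      f y                                                       ≈⟨ +-identityˡ (f y) ⟨
      0# + f y                                                  ≈⟨ +-congʳ (zeroˡ (f x)) ⟨
      0# * f x + f y                                            ≡⟨ off-diagonal (λ b → (if b then 1# else 0#) * f x + (if b then 0# else f y)) y≢x ⟨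
      δ y x * f x + (f without x) y                             ∎

  -- Zeroing f and g at the head index x lets the induction go on to the tail,
  -- whose coefficient at x need not vanish.
  ⟨⟩-cong-on-support : ∀ h {f g} → (∀ x → coeff h x ≈ 0# ⊎ f x ≈ g x) → ⟨ h , f ⟩ ≈ ⟨ h , g ⟩
  ⟨⟩-cong-on-support [] hyp = refl
  ⟨⟩-cong-on-support h@((a , x) ∷ h′) {f} {g} hyp = begin
    ⟨ h , f ⟩                                                   ≈⟨ ⟨⟩-split x h f ⟩
    coeff h x * f x + (a * (f without x) x + ⟨ h′ , f without x ⟩)
      ≈⟨ +-cong (at-x (hyp x)) (+-cong (*-congˡ (vanish-at-x f)) (⟨⟩-cong-on-support h′ hyp′)) ⟩
    coeff h x * g x + (a * 0# + ⟨ h′ , g without x ⟩)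
      ≈⟨ +-congˡ (+-congʳ (*-congˡ (vanish-at-x g))) ⟨
    coeff h x * g x + (a * (g without x) x + ⟨ h′ , g without x ⟩)
                                                                ≈⟨ ⟨⟩-split x h g ⟨
    ⟨ h , g ⟩                                                   ∎
    where
    at-x : coeff h x ≈ 0# ⊎ f x ≈ g x → coeff h x * f x ≈ coeff h x * g x
    at-x (inj₁ c≈0) = trans (*-congʳ c≈0) (trans (zeroˡ (f x)) (sym (trans (*-congʳ c≈0) (zeroˡ (g x)))))
    at-x (inj₂ f≈g) = *-congˡ f≈g
    vanish-at-x : ∀ f → (f without x) x ≈ 0#
    vanish-at-x f = reflexive (on-diagonal (λ b → if b then 0# else f x) x)
    hyp′ : ∀ y → coeff h′ y ≈ 0# ⊎ (f without x) y ≈ (g without x) y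
    hyp′ y with y ≟ x
    ... | yes _ = inj₂ refl
    ... | no y≢x with hyp y
    ...   | inj₁ c≈0 = inj₁ (trans (sym (coeff-∷-≢ a h′ (y≢x ∘ ≡.sym))) c≈0)
    ...   | inj₂ f≈g = inj₂ f≈g

  ⟨⟩-vanishes : ∀ h f → (∀ x → coeff h x ≈ 0#) → ⟨ h , f ⟩ ≈ 0#
  ⟨⟩-vanishes h f h≈0 = trans (⟨⟩-cong-on-support h (inj₁ ∘ h≈0)) (⟨⟩-0 h)

  ⟨⟩-congˡ : ∀ h h′ f → (∀ w → coeff h w ≈ coeff h′ w) → ⟨ h , f ⟩ ≈ ⟨ h′ , f ⟩
  ⟨⟩-congˡ h h′ f h≈h′ = x∙y⁻¹≈ε⇒x≈y _ _ (begin
    ⟨ h , f ⟩ + - ⟨ h′ , f ⟩              ≈⟨ +-congˡ (-1*x≈-x _) ⟨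
    ⟨ h , f ⟩ + - 1# * ⟨ h′ , f ⟩         ≈⟨ +-congˡ (⟨⟩-• (- 1#) h′ f) ⟨
    ⟨ h , f ⟩ + ⟨ (- 1#) • h′ , f ⟩       ≈⟨ ⟨⟩-++ h _ f ⟨
    ⟨ h ++ (- 1#) • h′ , f ⟩              ≈⟨ ⟨⟩-vanishes _ f difference-vanishes ⟩
    0#                                    ∎)
    where
    difference-vanishes : ∀ w → coeff (h ++ (- 1#) • h′) w ≈ 0#
    difference-vanishes w = begin
      coeff (h ++ (- 1#) • h′) w          ≈⟨ coeff-++ h _ w ⟩
      coeff h w + coeff ((- 1#) • h′) w   ≈⟨ +-cong (h≈h′ w) (trans (coeff-• (- 1#) h′ w) (-1*x≈-x _)) ⟩
      coeff h′ w + - coeff h′ w           ≈⟨ -‿inverseʳ _ ⟩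
      0#                                  ∎

  Unitriangular : (A → ℕ) → (A → Sum) → Set ℓ
  Unitriangular μ D = ∀ x y → μ x ≤ μ y → coeff (D x) y ≈ δ x y

  module _ (U : A → Bool) (D : A → Sum) where

    Decomposition : Sum → Set (c Level.⊔ ℓ)
    Decomposition h = ∃[ as ] ∃[ bs ]
      All (λ t → U (proj₂ t) ≡ false) as ×
      All (λ t → U (proj₂ t) ≡ true) bs ×
      (∀ w → coeff h w ≈ coeff (as ++ combination D bs) w)

    QuotientBasis : Set (c Level.⊔ ℓ)
    QuotientBasis =
      (∀ h → Decomposition h) ×
      (∀ as bs →
        All (λ t → U (proj₂ t) ≡ false) as →
        All (λ t → U (proj₂ t) ≡ true) bs →
        (∀ w → coeff as w ≈ coeff (combination D bs) w) →
        ∀ w → coeff as w ≈ 0#)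

  coeff-++-combination : ∀ as D bs w →
    coeff (as ++ combination D bs) w ≈ coeff as w + ⟨ bs , (λ x → coeff (D x) w) ⟩
  coeff-++-combination as D bs w = trans (coeff-++ as _ w) (+-congˡ (coeff-combination D bs w))

  coeff-T : ∀ x w → coeff (T x) w ≈ δ x w
  coeff-T x w = trans (coeff-as-pairing (T x) w) (trans (+-identityʳ _) (*-identityˡ _))

  module _ {U : A → Bool} {D : A → Sum} where

    decomposition-resp : ∀ {h h′} → (∀ w → coeff h w ≈ coeff h′ w) →
      Decomposition U D h′ → Decomposition U D h
    decomposition-resp h≈h′ (as , bs , as∉U , bs∈U , h′≈) =
      as , bs , as∉U , bs∈U , λ w → trans (h≈h′ w) (h′≈ w)

    decomposition-++ : ∀ {h h′} → Decomposition U D h → Decomposition U D h′ → Decomposition U D (h ++ h′)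
    decomposition-++ {h} {h′} (as , bs , as∉U , bs∈U , h≈) (as′ , bs′ , as′∉U , bs′∈U , h′≈) =
      as ++ as′ , bs ++ bs′ , ++⁺ as∉U as′∉U , ++⁺ bs∈U bs′∈U , λ w → begin
        coeff (h ++ h′) w
          ≈⟨ coeff-++ h h′ w ⟩
        coeff h w + coeff h′ w
          ≈⟨ +-cong (trans (h≈ w) (coeff-++-combination as D bs w)) (trans (h′≈ w) (coeff-++-combination as′ D bs′ w)) ⟩
        (coeff as w + ⟨ bs , _ ⟩) + (coeff as′ w + ⟨ bs′ , _ ⟩)
          ≈⟨ interchange _ _ _ _ ⟩
        (coeff as w + coeff as′ w) + (⟨ bs , _ ⟩ + ⟨ bs′ , _ ⟩)
          ≈⟨ +-cong (coeff-++ as as′ w) (⟨⟩-++ bs bs′ _) ⟨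
        coeff (as ++ as′) w + ⟨ bs ++ bs′ , _ ⟩
          ≈⟨ coeff-++-combination (as ++ as′) D (bs ++ bs′) w ⟨
        coeff ((as ++ as′) ++ combination D (bs ++ bs′)) w ∎

    decomposition-• : ∀ a {h} → Decomposition U D h → Decomposition U D (a • h)
    decomposition-• a {h} (as , bs , as∉U , bs∈U , h≈) =
      a • as , a • bs , map⁺ as∉U , map⁺ bs∈U , λ w → begin
        coeff (a • h) w                                   ≈⟨ coeff-• a h w ⟩
        a * coeff h w                                     ≈⟨ *-congˡ (trans (h≈ w) (coeff-++-combination as D bs w)) ⟩
        a * (coeff as w + ⟨ bs , _ ⟩)                     ≈⟨ distribˡ a _ _ ⟩
        a * coeff as w + a * ⟨ bs , _ ⟩                   ≈⟨ +-cong (coeff-• a as w) (⟨⟩-• a bs _) ⟨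
        coeff (a • as) w + ⟨ a • bs , _ ⟩                 ≈⟨ coeff-++-combination (a • as) D (a • bs) w ⟨
        coeff (a • as ++ combination D (a • bs)) w        ∎

    decomposition-all : ∀ h → All (Decomposition U D ∘ T ∘ proj₂) h → Decomposition U D h
    decomposition-all [] [] = [] , [] , [] , [] , λ w → refl
    decomposition-all ((a , x) ∷ h) (Tx ∷ rest) =
      decomposition-++ (decomposition-resp scaled-T (decomposition-• a Tx)) (decomposition-all h rest)
      where
      scaled-T : ∀ w → coeff ((a , x) ∷ []) w ≈ coeff (a • T x) w
      scaled-T w = begin
        coeff ((a , x) ∷ []) w            ≈⟨ coeff-as-pairing _ w ⟩
        a * δ x w + 0#                    ≈⟨ +-congʳ (*-congʳ (*-identityʳ a)) ⟨
        (a * 1#) * δ x w + 0#             ≈⟨ coeff-as-pairing _ w ⟨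
        coeff (a • T x) w                 ∎

  module _ (μ : A → ℕ) {D : A → Sum} (D-unitriangular : Unitriangular μ D) (U : A → Bool) where

    lower : A → Sum
    lower x = filter ((λ y → μ y <? μ x) ∘ proj₂) (D x)

    T≈D-lower : ∀ x w → coeff (T x) w ≈ coeff (D x) w + - coeff (lower x) w
    T≈D-lower x w with μ w <? μ x
    ... | yes μw<μx = begin
      coeff (T x) w                            ≈⟨ coeff-T x w ⟩
      δ x w                                    ≈⟨ δ-≢ (λ { ≡.refl → <⇒≢ μw<μx ≡.refl }) ⟩
      0#                                       ≈⟨ -‿inverseʳ _ ⟨
      coeff (D x) w + - coeff (D x) w          ≈⟨ +-congˡ (-‿cong (coeff-filter-accept (λ y → μ y <? μ x) (D x) μw<μx)) ⟨
      coeff (D x) w + - coeff (lower x) w      ∎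
    ... | no μw≮μx = begin
      coeff (T x) w                            ≈⟨ coeff-T x w ⟩
      δ x w                                    ≈⟨ D-unitriangular x w (≮⇒≥ μw≮μx) ⟨
      coeff (D x) w                            ≈⟨ +-identityʳ _ ⟨
      coeff (D x) w + 0#                       ≈⟨ +-congˡ (trans (-‿cong (coeff-filter-reject (λ y → μ y <? μ x) (D x) μw≮μx)) -0#≈0#) ⟨
      coeff (D x) w + - coeff (lower x) w      ∎

    decomposition-T : ∀ x → Decomposition U D (T x)
    decomposition-T = upward-induction μ (Decomposition U D ∘ T) step
      where
      step : ∀ x → (∀ y → μ y < μ x → Decomposition U D (T y)) → Decomposition U D (T x)
      step x ih with U x in Ux
      ... | false = T x , [] , Ux ∷ [] , [] , λ w → refl
      ... | true with decomposition-• (- 1#) (decomposition-all (lower x)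
                        (All.map (ih _) (all-filter ((λ y → μ y <? μ x) ∘ proj₂) (D x))))
      ... | as , bs , as∉U , bs∈U , as≈ = as , (1# , x) ∷ bs , as∉U , Ux ∷ bs∈U , λ w → begin
        coeff (T x) w                                          ≈⟨ T≈D-lower x w ⟩
        coeff (D x) w + - coeff (lower x) w                    ≈⟨ +-congˡ (trans (coeff-• (- 1#) (lower x) w) (-1*x≈-x _)) ⟨
        coeff (D x) w + coeff ((- 1#) • lower x) w             ≈⟨ +-congˡ (trans (as≈ w) (coeff-++-combination as D bs w)) ⟩
        coeff (D x) w + (coeff as w + ⟨ bs , _ ⟩)              ≈⟨ x∙yz≈y∙xz _ _ _ ⟩
        coeff as w + (coeff (D x) w + ⟨ bs , _ ⟩)              ≈⟨ +-congˡ (+-congʳ (*-identityˡ _)) ⟨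
        coeff as w + ⟨ (1# , x) ∷ bs , (λ y → coeff (D y) w) ⟩ ≈⟨ coeff-++-combination as D ((1# , x) ∷ bs) w ⟨
        coeff (as ++ combination D ((1# , x) ∷ bs)) w          ∎

    spanning : ∀ h → Decomposition U D h
    spanning h = decomposition-all h (universal (decomposition-T ∘ proj₂) h)

    independence : ∀ {B} → (∀ x → μ x ≤ B) → ∀ as bs →
      All (λ t → U (proj₂ t) ≡ false) as →
      All (λ t → U (proj₂ t) ≡ true) bs →
      (∀ w → coeff as w ≈ coeff (combination D bs) w) →
      ∀ w → coeff as w ≈ 0#
    independence μ≤B as bs as∉U bs∈U as≈ w = begin
      coeff as w                             ≈⟨ as≈ w ⟩
      coeff (combination D bs) w             ≈⟨ coeff-combination D bs w ⟩
      ⟨ bs , (λ x → coeff (D x) w) ⟩          ≈⟨ ⟨⟩-vanishes bs _ bs≈0 ⟩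
      0#                                     ∎
      where
      step : ∀ x → (∀ y → μ x < μ y → coeff bs y ≈ 0#) → coeff bs x ≈ 0#
      step x ih with U x in Ux
      ... | false = coeff-vanishes-off bs∈U (not-¬ Ux)
      ... | true = begin
        coeff bs x                           ≈⟨ coeff-as-pairing bs x ⟩
        ⟨ bs , (λ y → δ y x) ⟩                ≈⟨ ⟨⟩-cong-on-support bs support ⟩
        ⟨ bs , (λ y → coeff (D y) x) ⟩        ≈⟨ coeff-combination D bs x ⟨
        coeff (combination D bs) x           ≈⟨ as≈ x ⟨
        coeff as x                           ≈⟨ coeff-vanishes-off as∉U (not-¬ Ux) ⟩
        0#                                   ∎
        where
        support : ∀ y → coeff bs y ≈ 0# ⊎ δ y x ≈ coeff (D y) x
        support y with μ y ≤? μ x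
        ... | yes μy≤μx = inj₂ (sym (D-unitriangular y x μy≤μx))
        ... | no μy≰μx = inj₁ (ih y (≰⇒> μy≰μx))
      bs≈0 : ∀ x → coeff bs x ≈ 0#
      bs≈0 = downward-induction μ (λ x → coeff bs x ≈ 0#) μ≤B step

  unitriangular⇒quotientBasis : ∀ (μ : A → ℕ) {B} → (∀ x → μ x ≤ B) →
    ∀ {D} → Unitriangular μ D → ∀ U → QuotientBasis U D
  unitriangular⇒quotientBasis μ μ≤B D-unitriangular U =
    spanning μ D-unitriangular U , independence μ D-unitriangular U μ≤B

module Laurent where

  open import Level using (0ℓ)
  open import Relation.Binary.Structures using (IsEquivalence)
  open import Data.Bool using (true; false)
  open import Data.Integer as ℤ using (ℤ; 0ℤ; 1ℤ; _+_; _*_; _-_; -_)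
  import Data.Integer.Properties as ℤ
  open import Data.Integer.Tactic.RingSolver using (solve-∀)
  open import Data.List using (_++_; map)
  open import Data.List.Properties using (map-++; ++-assoc; ++-identityʳ)
  open import Data.Product using (proj₁; proj₂; swap)
  open import Function.Bundles using (mk⇔)
  open import Relation.Binary.PropositionalEquality
  open import Relation.Nullary using (yes; no)
  open import Relation.Nullary.Decidable using (does-⇔)

  private
    [i+j]-i≡j : ∀ i j → (i + j) - i ≡ j
    [i+j]-i≡j = solve-∀
    i+[j-i]≡j : ∀ i j → i + (j - i) ≡ j
    i+[j-i]≡j = solve-∀
    k-[i+j]≡[k-i]-j : ∀ k i j → k - (i + j) ≡ (k - i) - j
    k-[i+j]≡[k-i]-j = solve-∀

  -- L lists (exponent, coefficient) pairs; swapped, they form a ℤ-combination of exponents.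
  terms : L → List (ℤ × ℤ)
  terms = map swap

  module ℤSum = FormalSum ℤ.+-*-ring ℤ._≟_ (λ h → coeffL (terms h)) (λ _ → refl) (λ _ _ _ _ → refl)

  ⟪_,_⟫ : L → (ℤ → ℤ) → ℤ
  ⟪ p , f ⟫ = ℤSum.⟨ terms p , f ⟩

  terms-involutive : ∀ p → terms (terms p) ≡ p
  terms-involutive []      = refl
  terms-involutive (m ∷ p) = cong (m ∷_) (terms-involutive p)

  coeffL-++ : ∀ p q k → coeffL (p ++ q) k ≡ coeffL p k + coeffL q k
  coeffL-++ []            q k = sym (ℤ.+-identityˡ _)
  coeffL-++ ((e , c) ∷ p) q k =
    trans (cong (m +_) (coeffL-++ p q k)) (sym (ℤ.+-assoc m (coeffL p k) (coeffL q k)))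
    where
    m : ℤ
    m = if does (e ℤ.≟ k) then c else 0ℤ

  coeffL-neg : ∀ p k → coeffL (-L p) k ≡ - coeffL p k
  coeffL-neg []            k = refl
  coeffL-neg ((e , c) ∷ p) k with does (e ℤ.≟ k)
  ... | true  = trans (cong (λ z → - c + z) (coeffL-neg p k)) (sym (ℤ.neg-distrib-+ c (coeffL p k)))
  ... | false = trans (cong (λ z → 0ℤ + z) (coeffL-neg p k)) (sym (ℤ.neg-distrib-+ 0ℤ (coeffL p k)))

  coeffL-bar : ∀ p k → coeffL (barL p) k ≡ coeffL p (- k)
  coeffL-bar []            k = refl
  coeffL-bar ((e , c) ∷ p) k = cong₂ _+_
    (cong (λ b → if b then c else 0ℤ) (does-⇔ (mk⇔ -e≡k⇒e≡-k e≡-k⇒-e≡k) (- e ℤ.≟ k) (e ℤ.≟ - k)))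
    (coeffL-bar p k)
    where
    -e≡k⇒e≡-k : - e ≡ k → e ≡ - k
    -e≡k⇒e≡-k refl = sym (ℤ.neg-involutive e)
    e≡-k⇒-e≡k : e ≡ - k → - e ≡ k
    e≡-k⇒-e≡k refl = ℤ.neg-involutive k

  coeffL-as-pairing : ∀ p k → coeffL p k ≡ ⟪ p , (λ e → ℤSum.δ e k) ⟫
  coeffL-as-pairing p k =
    trans (cong (λ q → coeffL q k) (sym (terms-involutive p))) (ℤSum.coeff-as-pairing (terms p) k)

  ⟪⟫-congˡ : ∀ p q f → p ≈L q → ⟪ p , f ⟫ ≡ ⟪ q , f ⟫
  ⟪⟫-congˡ p q f p≈q = ℤSum.⟨⟩-congˡ (terms p) (terms q) f λ k →
    trans (cong (λ r → coeffL r k) (terms-involutive p))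
          (trans (p≈q k) (cong (λ r → coeffL r k) (sym (terms-involutive q))))

  ⟪⟫-++ : ∀ p q f → ⟪ p ++ q , f ⟫ ≡ ⟪ p , f ⟫ + ⟪ q , f ⟫
  ⟪⟫-++ p q f = trans (cong ℤSum.⟨_, f ⟩ (map-++ swap p q)) (ℤSum.⟨⟩-++ (terms p) (terms q) f)

  ⟪⟫-congʳ : ∀ p {f g} → (∀ e → f e ≡ g e) → ⟪ p , f ⟫ ≡ ⟪ p , g ⟫
  ⟪⟫-congʳ p = ℤSum.⟨⟩-congʳ (terms p)

  ⟪⟫-+ : ∀ p f g → ⟪ p , (λ e → f e + g e) ⟫ ≡ ⟪ p , f ⟫ + ⟪ p , g ⟫
  ⟪⟫-+ p = ℤSum.⟨⟩-+ (terms p)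

  monomial*L : ℤ × ℤ → L → L
  monomial*L (e , c) q = map (λ m → (e + proj₁ m , c * proj₂ m)) q

  coeffL-monomial* : ∀ e c q k → coeffL (monomial*L (e , c) q) k ≡ c * coeffL q (k - e)
  coeffL-monomial* e c []              k = sym (ℤ.*-zeroʳ c)
  coeffL-monomial* e c ((e′ , c′) ∷ q) k
    rewrite does-⇔ (mk⇔ (λ eq → trans (sym ([i+j]-i≡j e e′)) (cong (_- e) eq))
                        (λ eq → trans (cong (e +_) eq) (i+[j-i]≡j e k)))
                   (e + e′ ℤ.≟ k) (e′ ℤ.≟ k - e)
          | coeffL-monomial* e c q k
    with does (e′ ℤ.≟ k - e)
  ... | true  = sym (ℤ.*-distribˡ-+ c c′ _)
  ... | false = trans (ℤ.+-identityˡ _) (cong (c *_) (sym (ℤ.+-identityˡ _)))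

  coeffL-* : ∀ p q k → coeffL (p *L q) k ≡ ⟪ p , (λ e → coeffL q (k - e)) ⟫
  coeffL-* []            q k = refl
  coeffL-* ((e , c) ∷ p) q k =
    trans (coeffL-++ (monomial*L (e , c) q) (p *L q) k)
          (cong₂ _+_ (coeffL-monomial* e c q k) (coeffL-* p q k))

  ⟪⟫-monomial* : ∀ e c q f → ⟪ monomial*L (e , c) q , f ⟫ ≡ c * ⟪ q , (λ e′ → f (e + e′)) ⟫
  ⟪⟫-monomial* e c []              f = sym (ℤ.*-zeroʳ c)
  ⟪⟫-monomial* e c ((e′ , c′) ∷ q) f =
    trans (cong₂ _+_ (ℤ.*-assoc c c′ _) (⟪⟫-monomial* e c q f)) (sym (ℤ.*-distribˡ-+ c _ _))

  ⟪⟫-* : ∀ p q f → ⟪ p *L q , f ⟫ ≡ ⟪ p , (λ e → ⟪ q , (λ e′ → f (e + e′)) ⟫) ⟫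
  ⟪⟫-* []            q f = refl
  ⟪⟫-* ((e , c) ∷ p) q f =
    trans (⟪⟫-++ (monomial*L (e , c) q) (p *L q) f)
          (cong₂ _+_ (⟪⟫-monomial* e c q f) (⟪⟫-* p q f))

  -- A record rather than _≈L_ itself, so that ring lemmas can infer their implicit arguments.
  record _≈ᴸ_ (p q : L) : Set where
    constructor coeffwise
    field coeffs : p ≈L q
  open _≈ᴸ_ public

  open import Algebra.Definitions _≈ᴸ_

  private
    coeffwise-≡ : ∀ {p q} → p ≡ q → p ≈ᴸ q
    coeffwise-≡ p≡q = coeffwise (λ k → cong (λ r → coeffL r k) p≡q)

  ≈ᴸ-isEquivalence : IsEquivalence _≈ᴸ_
  ≈ᴸ-isEquivalence = record
    { refl  = coeffwise (λ k → refl)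
    ; sym   = λ p≈q → coeffwise (λ k → sym (coeffs p≈q k))
    ; trans = λ p≈q q≈r → coeffwise (λ k → trans (coeffs p≈q k) (coeffs q≈r k))
    }

  +L-cong : Congruent₂ _+L_
  +L-cong {p} {p′} {q} {q′} p≈p′ q≈q′ = coeffwise λ k →
    trans (coeffL-++ p q k) (trans (cong₂ _+_ (coeffs p≈p′ k) (coeffs q≈q′ k)) (sym (coeffL-++ p′ q′ k)))

  +L-comm : Commutative _+L_
  +L-comm p q = coeffwise λ k →
    trans (coeffL-++ p q k) (trans (ℤ.+-comm (coeffL p k) _) (sym (coeffL-++ q p k)))

  -L-cong : Congruent₁ -L_
  -L-cong {p} {q} p≈q = coeffwise λ k →
    trans (coeffL-neg p k) (trans (cong -_ (coeffs p≈q k)) (sym (coeffL-neg q k)))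

  -L-inverseˡ : LeftInverse 0L -L_ _+L_
  -L-inverseˡ p = coeffwise λ k →
    trans (coeffL-++ (-L p) p k) (trans (cong (_+ coeffL p k) (coeffL-neg p k)) (ℤ.+-inverseˡ (coeffL p k)))

  -L-inverseʳ : RightInverse 0L -L_ _+L_
  -L-inverseʳ p = ≈ᴸ-trans (+L-comm p (-L p)) (-L-inverseˡ p)
    where open IsEquivalence ≈ᴸ-isEquivalence renaming (trans to ≈ᴸ-trans)

  *L-cong : Congruent₂ _*L_
  *L-cong {p} {p′} {q} {q′} p≈p′ q≈q′ = coeffwise λ k → begin
    coeffL (p *L q) k                       ≡⟨ coeffL-* p q k ⟩
    ⟪ p , (λ e → coeffL q (k - e)) ⟫         ≡⟨ ⟪⟫-congˡ p p′ _ (coeffs p≈p′) ⟩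
    ⟪ p′ , (λ e → coeffL q (k - e)) ⟫        ≡⟨ ⟪⟫-congʳ p′ (λ e → coeffs q≈q′ (k - e)) ⟩
    ⟪ p′ , (λ e → coeffL q′ (k - e)) ⟫       ≡⟨ coeffL-* p′ q′ k ⟨
    coeffL (p′ *L q′) k                     ∎
    where open ≡-Reasoning

  *L-assoc : Associative _*L_
  *L-assoc p q r = coeffwise λ k → begin
    coeffL ((p *L q) *L r) k                                        ≡⟨ coeffL-* (p *L q) r k ⟩
    ⟪ p *L q , (λ e → coeffL r (k - e)) ⟫                            ≡⟨ ⟪⟫-* p q _ ⟩
    ⟪ p , (λ e → ⟪ q , (λ e′ → coeffL r (k - (e + e′))) ⟫) ⟫
      ≡⟨ ⟪⟫-congʳ p (λ e → ⟪⟫-congʳ q (λ e′ → cong (coeffL r) (k-[i+j]≡[k-i]-j k e e′))) ⟩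
    ⟪ p , (λ e → ⟪ q , (λ e′ → coeffL r ((k - e) - e′)) ⟫) ⟫         ≡⟨ ⟪⟫-congʳ p (λ e → coeffL-* q r (k - e)) ⟨
    ⟪ p , (λ e → coeffL (q *L r) (k - e)) ⟫                          ≡⟨ coeffL-* p (q *L r) k ⟨
    coeffL (p *L (q *L r)) k                                        ∎
    where open ≡-Reasoning

  *L-identityˡ : LeftIdentity 1L _*L_
  *L-identityˡ p = coeffwise λ k →
    trans (coeffL-* 1L p k)
          (trans (ℤ.+-identityʳ _) (trans (ℤ.*-identityˡ _) (cong (coeffL p) (ℤ.+-identityʳ k))))

  *L-identityʳ : RightIdentity 1L _*L_
  *L-identityʳ p = coeffwise λ k →
    trans (coeffL-* p 1L k) (trans (⟪⟫-congʳ p (λ e → one e k)) (sym (coeffL-as-pairing p k)))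
    where
    one : ∀ e k → coeffL 1L (k - e) ≡ ℤSum.δ e k
    one e k = trans (ℤ.+-identityʳ _) (cong (λ b → if b then 1ℤ else 0ℤ)
      (does-⇔ (mk⇔ (λ 0≡k-e → trans (sym (ℤ.+-identityʳ e)) (trans (cong (e +_) 0≡k-e) (i+[j-i]≡j e k)))
                   (λ { refl → sym (ℤ.+-inverseʳ e) }))
              (0ℤ ℤ.≟ k - e) (e ℤ.≟ k)))

  *L-distribˡ : _*L_ DistributesOverˡ _+L_
  *L-distribˡ p q r = coeffwise λ k → begin
    coeffL (p *L (q ++ r)) k                                           ≡⟨ coeffL-* p (q ++ r) k ⟩
    ⟪ p , (λ e → coeffL (q ++ r) (k - e)) ⟫                             ≡⟨ ⟪⟫-congʳ p (λ e → coeffL-++ q r (k - e)) ⟩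
    ⟪ p , (λ e → coeffL q (k - e) + coeffL r (k - e)) ⟫                 ≡⟨ ⟪⟫-+ p _ _ ⟩
    ⟪ p , (λ e → coeffL q (k - e)) ⟫ + ⟪ p , (λ e → coeffL r (k - e)) ⟫ ≡⟨ cong₂ _+_ (coeffL-* p q k) (coeffL-* p r k) ⟨
    coeffL (p *L q) k + coeffL (p *L r) k                              ≡⟨ coeffL-++ (p *L q) (p *L r) k ⟨
    coeffL ((p *L q) ++ (p *L r)) k                                    ∎
    where open ≡-Reasoning

  *L-distribʳ : _*L_ DistributesOverʳ _+L_
  *L-distribʳ p q r = coeffwise λ k → begin
    coeffL ((q ++ r) *L p) k                                           ≡⟨ coeffL-* (q ++ r) p k ⟩
    ⟪ q ++ r , (λ e → coeffL p (k - e)) ⟫                               ≡⟨ ⟪⟫-++ q r _ ⟩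
    ⟪ q , (λ e → coeffL p (k - e)) ⟫ + ⟪ r , (λ e → coeffL p (k - e)) ⟫ ≡⟨ cong₂ _+_ (coeffL-* q p k) (coeffL-* r p k) ⟨
    coeffL (q *L p) k + coeffL (r *L p) k                              ≡⟨ coeffL-++ (q *L p) (r *L p) k ⟨
    coeffL ((q *L p) ++ (r *L p)) k                                    ∎
    where open ≡-Reasoning

  Laurent : Ring 0ℓ 0ℓ
  Laurent = record
    { Carrier = L ; _≈_ = _≈ᴸ_ ; _+_ = _+L_ ; _*_ = _*L_ ; -_ = -L_ ; 0# = 0L ; 1# = 1L
    ; isRing = record
      { +-isAbelianGroup = record
        { isGroup = record
          { isMonoid = record
            { isSemigroup = record
              { isMagma = record { isEquivalence = ≈ᴸ-isEquivalence ; ∙-cong = +L-cong }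
              ; assoc = λ p q r → coeffwise-≡ (++-assoc p q r)
              }
            ; identity = (λ p → coeffwise-≡ refl) , (λ p → coeffwise-≡ (++-identityʳ p))
            }
          ; inverse = -L-inverseˡ , -L-inverseʳ
          ; ⁻¹-cong = -L-cong
          }
        ; comm = +L-comm
        }
      ; *-cong = *L-cong
      ; *-assoc = *L-assoc
      ; *-identity = *L-identityˡ , *L-identityʳ
      ; distrib = *L-distribˡ , *L-distribʳ
      }
    }

  barL-cong : ∀ p q → p ≈L q → barL p ≈L barL q
  barL-cong p q p≈q k = trans (coeffL-bar p k) (trans (p≈q (- k)) (sym (coeffL-bar q k)))

  barL-++ : ∀ p q → barL (p ++ q) ≡ barL p ++ barL q
  barL-++ = map-++ _

  bar-invariant∧InVZv⇒0 : ∀ {p} → barL p ≈L p → InVZv p → p ≈L 0L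
  bar-invariant∧InVZv⇒0 {p} bar-invariant p∈vℤ[v] k with k ℤ.≤? 0ℤ
  ... | yes k≤0 = p∈vℤ[v] k k≤0
  ... | no k≰0  = begin
    coeffL p k          ≡⟨ bar-invariant k ⟨
    coeffL (barL p) k   ≡⟨ coeffL-bar p k ⟩
    coeffL p (- k)      ≡⟨ p∈vℤ[v] (- k) (ℤ.neg-mono-≤ (ℤ.<⇒≤ (ℤ.≰⇒> k≰0))) ⟩
    0ℤ                  ∎
    where open ≡-Reasoning

  ev1-++ : ∀ p q → ev1 (p ++ q) ≡ ev1 p + ev1 q
  ev1-++ []            q = sym (ℤ.+-identityˡ _)
  ev1-++ ((e , c) ∷ p) q = trans (cong (c +_) (ev1-++ p q)) (sym (ℤ.+-assoc c (ev1 p) (ev1 q)))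

  ev1-cong : ∀ p q → p ≈L q → ev1 p ≡ ev1 q
  ev1-cong p q p≈q = trans (ev1-as-pairing p) (trans (⟪⟫-congˡ p q _ p≈q) (sym (ev1-as-pairing q)))
    where
    ev1-as-pairing : ∀ p → ev1 p ≡ ⟪ p , (λ _ → 1ℤ) ⟫
    ev1-as-pairing []            = refl
    ev1-as-pairing ((e , c) ∷ p) = cong₂ _+_ (sym (ℤ.*-identityʳ c)) (ev1-as-pairing p)

module Permutation where

  open import Data.Bool using (true; false; T)
  open import Data.Bool.Properties using (T-irrelevant)
  open import Data.Empty using (⊥-elim)
  open import Data.Fin using (Fin; toℕ; fromℕ<)
  open import Data.Fin.Properties using (toℕ-fromℕ<; toℕ-injective) renaming (_≟_ to _≟F_)
  open import Data.List using (map; length)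
  open import Data.List.Relation.Unary.All using (All; []; _∷_)
  import Data.List.Relation.Unary.All as All
  open import Data.Maybe using (Maybe; just; nothing)
  open import Data.Nat using (suc; _+_; _*_; _≤_; _<_; _<ᵇ_; z≤n; s≤s)
  open import Data.Nat.Properties
  open import Data.Product using (proj₁; proj₂)
  open import Data.Sum using (_⊎_; inj₁; inj₂)
  open import Data.Vec as Vec using (toList)
  open import Data.Vec.Properties using (≡-dec; map-∘; map-cong; map-id; toList-map; length-toList)
  open import Function using (_∘_)
  open import Function.Bundles using (_⇔_; mk⇔)
  open import Function.Construct.Identity using (⇔-id)
  open import Function.Construct.Symmetry using (⇔-sym)
  open import Relation.Binary.PropositionalEquality
  open import Relation.Nullary using (¬_; Dec; yes; no)
  open import Relation.Nullary.Decidable using (map′; dec-true; dec-false; does-⇔; _×-dec_; _⊎-dec_)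

  W-≡ : ∀ {n} {x y : W n} → proj₁ x ≡ proj₁ y → x ≡ y
  W-≡ {x = v , pv} {y = .v , pv′} refl = cong (v ,_) (T-irrelevant pv pv′)

  -- Decided via the entries, so that does (x ≟W y) is definitionally x ==W y.
  _≟W_ : ∀ {n} → DecidableEquality (W n)
  x ≟W y = map′ W-≡ (cong proj₁) (≡-dec _≟F_ (proj₁ x) (proj₁ y))

  distinct-∷ : ∀ {n} (x : Fin n) xs → T (allDistinct (x ∷ xs)) → All (x ≢_) xs × T (allDistinct xs)
  distinct-∷ x xs d with anyEq x xs in x∉xs
  ... | false = not-anyEq xs x∉xs , d
    where
    not-anyEq : ∀ ys → anyEq x ys ≡ false → All (x ≢_) ys
    not-anyEq []       _ = []
    not-anyEq (y ∷ ys) e with x ≟F y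
    ... | no x≢y = x≢y ∷ not-anyEq ys e

  module Transposition {n} (s : S n) where

    i j : Fin n
    i = proj₁ s
    j = fromℕ< (proj₂ s)

    σ : Fin n → Fin n
    σ = sFun s

    toℕ-j : toℕ j ≡ suc (toℕ i)
    toℕ-j = toℕ-fromℕ< (proj₂ s)

    i≢j : i ≢ j
    i≢j i≡j = 1+n≢n (sym (trans (cong toℕ i≡j) toℕ-j))

    σ-i : σ i ≡ j
    σ-i rewrite dec-true (i ≟F i) refl = refl

    σ-j : σ j ≡ i
    σ-j rewrite dec-false (j ≟F i) (i≢j ∘ sym) | dec-true (j ≟F j) refl = refl

    σ-other : ∀ {k} → k ≢ i → k ≢ j → σ k ≡ k
    σ-other {k} k≢i k≢j rewrite dec-false (k ≟F i) k≢i | dec-false (k ≟F j) k≢j = refl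

    data Position (k : Fin n) : Set where
      at-i      : k ≡ i → Position k
      at-j      : k ≡ j → Position k
      elsewhere : k ≢ i → k ≢ j → Position k

    position : ∀ k → Position k
    position k with k ≟F i | k ≟F j
    ... | yes k≡i | _       = at-i k≡i
    ... | no _    | yes k≡j = at-j k≡j
    ... | no k≢i  | no k≢j  = elsewhere k≢i k≢j

    σ-involutive : ∀ k → σ (σ k) ≡ k
    σ-involutive k with position k
    ... | at-i refl          = trans (cong σ σ-i) σ-j
    ... | at-j refl          = trans (cong σ σ-j) σ-i
    ... | elsewhere k≢i k≢j  = trans (cong σ (σ-other k≢i k≢j)) (σ-other k≢i k≢j)

    Swapped : Fin n → Fin n → Set
    Swapped x y = (x ≡ i × y ≡ j) ⊎ (x ≡ j × y ≡ i)

    Swapped? : ∀ x y → Dec (Swapped x y)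
    Swapped? x y = ((x ≟F i) ×-dec (y ≟F j)) ⊎-dec ((x ≟F j) ×-dec (y ≟F i))

    Swapped-unique : ∀ {x y z} → Swapped x y → Swapped x z → y ≡ z
    Swapped-unique (inj₁ (_ , refl))   (inj₁ (_ , refl))   = refl
    Swapped-unique (inj₁ (refl , _))   (inj₂ (i≡j , _))    = ⊥-elim (i≢j i≡j)
    Swapped-unique (inj₂ (refl , _))   (inj₁ (j≡i , _))    = ⊥-elim (i≢j (sym j≡i))
    Swapped-unique (inj₂ (_ , refl))   (inj₂ (_ , refl))   = refl

    Swapped-covers : ∀ {k y z} → k ≡ i ⊎ k ≡ j → Swapped y z → k ≡ y ⊎ k ≡ z
    Swapped-covers (inj₁ refl) (inj₁ (y≡i , _)) = inj₁ (sym y≡i)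
    Swapped-covers (inj₁ refl) (inj₂ (_ , z≡i)) = inj₂ (sym z≡i)
    Swapped-covers (inj₂ refl) (inj₁ (_ , z≡j)) = inj₂ (sym z≡j)
    Swapped-covers (inj₂ refl) (inj₂ (y≡j , _)) = inj₁ (sym y≡j)

    private
      irrefl⇔ : ∀ {m m′} → (m < m) ⇔ (m′ < m′)
      irrefl⇔ = mk⇔ (⊥-elim ∘ <-irrefl refl) (⊥-elim ∘ <-irrefl refl)

      below-suc : ∀ {m a} → m ≢ a → (m < suc a) ⇔ (m < a)
      below-suc m≢a = mk⇔ (λ m<1+a → ≤∧≢⇒< (m<1+n⇒m≤n m<1+a) m≢a) m<n⇒m<1+n

      above-suc : ∀ {m a} → m ≢ suc a → (suc a < m) ⇔ (a < m)
      above-suc m≢1+a = mk⇔ (<-trans (n<1+n _)) (λ a<m → ≤∧≢⇒< a<m (m≢1+a ∘ sym))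

      toℕ-≢ : ∀ {x y : Fin n} → x ≢ y → toℕ x ≢ toℕ y
      toℕ-≢ x≢y = x≢y ∘ toℕ-injective

    σ-order : ∀ x y → ¬ Swapped x y → (toℕ (σ y) < toℕ (σ x)) ⇔ (toℕ y < toℕ x)
    σ-order x y ¬sw with position x | position y
    ... | at-i refl | at-i refl = irrefl⇔
    ... | at-i refl | at-j refl = ⊥-elim (¬sw (inj₁ (refl , refl)))
    ... | at-i refl | elsewhere y≢i y≢j
      rewrite σ-i | σ-other y≢i y≢j | toℕ-j = below-suc (toℕ-≢ y≢i)
    ... | at-j refl | at-i refl = ⊥-elim (¬sw (inj₂ (refl , refl)))
    ... | at-j refl | at-j refl = irrefl⇔
    ... | at-j refl | elsewhere y≢i y≢j
      rewrite σ-j | σ-other y≢i y≢j | toℕ-j = ⇔-sym (below-suc (toℕ-≢ y≢i))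
    ... | elsewhere x≢i x≢j | at-i refl
      rewrite σ-i | σ-other x≢i x≢j | toℕ-j = above-suc (subst (toℕ x ≢_) toℕ-j (toℕ-≢ x≢j))
    ... | elsewhere x≢i x≢j | at-j refl
      rewrite σ-j | σ-other x≢i x≢j | toℕ-j = ⇔-sym (above-suc (subst (toℕ x ≢_) toℕ-j (toℕ-≢ x≢j)))
    ... | elsewhere x≢i x≢j | elsewhere y≢i y≢j
      rewrite σ-other x≢i x≢j | σ-other y≢i y≢j = ⇔-id _

    σ-preserves-<ᵇ : ∀ {x y} → ¬ Swapped x y → (toℕ (σ y) <ᵇ toℕ (σ x)) ≡ (toℕ y <ᵇ toℕ x)
    σ-preserves-<ᵇ {x} {y} ¬sw = does-⇔ (σ-order x y ¬sw) (toℕ (σ y) <? toℕ (σ x)) (toℕ y <? toℕ x)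

    countLess-σ-unswapped : ∀ x {ys} → All (¬_ ∘ Swapped x) ys →
      countLess (σ x) (map σ ys) ≡ countLess x ys
    countLess-σ-unswapped x []            = refl
    countLess-σ-unswapped x (¬sw ∷ ¬sws) =
      cong₂ _+_ (cong (λ b → if b then 1 else 0) (σ-preserves-<ᵇ ¬sw)) (countLess-σ-unswapped x ¬sws)

    countLess-σ : ∀ x ys → T (allDistinct ys) → countLess (σ x) (map σ ys) ≤ suc (countLess x ys)
    countLess-σ x []       _ = z≤n
    countLess-σ x (y ∷ ys) d = by-cases (Swapped? x y)
      where
      open ≤-Reasoning
      χ< : Fin n → Fin n → ℕ
      χ< a b = if toℕ a <ᵇ toℕ b then 1 else 0
      χ<≤1 : ∀ a b → χ< a b ≤ 1
      χ<≤1 a b with toℕ a <ᵇ toℕ b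
      ... | true  = ≤-refl
      ... | false = z≤n
      by-cases : Dec (Swapped x y) → countLess (σ x) (map σ (y ∷ ys)) ≤ suc (countLess x (y ∷ ys))
      by-cases (no ¬sw) = begin
        χ< (σ y) (σ x) + countLess (σ x) (map σ ys)   ≡⟨ cong (λ b → (if b then 1 else 0) + countLess (σ x) (map σ ys)) (σ-preserves-<ᵇ ¬sw) ⟩
        χ< y x + countLess (σ x) (map σ ys)       ≤⟨ +-monoʳ-≤ (χ< y x) (countLess-σ x ys (proj₂ (distinct-∷ y ys d))) ⟩
        χ< y x + suc (countLess x ys)             ≡⟨ +-suc (χ< y x) _ ⟩
        suc (χ< y x + countLess x ys)             ∎
      by-cases (yes sw) = begin
        χ< (σ y) (σ x) + countLess (σ x) (map σ ys)   ≡⟨ cong (χ< (σ y) (σ x) +_) (countLess-σ-unswapped x ys-unswapped) ⟩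
        χ< (σ y) (σ x) + countLess x ys               ≤⟨ +-monoˡ-≤ (countLess x ys) (χ<≤1 (σ y) (σ x)) ⟩
        suc (countLess x ys)                         ≤⟨ s≤s (m≤n+m _ (χ< y x)) ⟩
        suc (χ< y x + countLess x ys)             ∎
        where
        ys-unswapped : All (¬_ ∘ Swapped x) ys
        ys-unswapped = All.map (λ y≢z sw′ → y≢z (Swapped-unique sw sw′)) (proj₁ (distinct-∷ y ys d))

    inversions-σ-avoiding : ∀ {k} → k ≡ i ⊎ k ≡ j → ∀ {ys} → All (k ≢_) ys →
      inversions (map σ ys) ≡ inversions ys
    inversions-σ-avoiding moved []               = refl
    inversions-σ-avoiding moved (k≢y ∷ k∉ys) =
      cong₂ _+_ (countLess-σ-unswapped _ (All.map unswapped k∉ys)) (inversions-σ-avoiding moved k∉ys)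
      where
      unswapped : ∀ {z} → _ ≢ z → ¬ Swapped _ z
      unswapped k≢z sw with Swapped-covers moved sw
      ... | inj₁ k≡y = k≢y k≡y
      ... | inj₂ k≡z = k≢z k≡z

    inversions-σ-moved : ∀ {x} → x ≡ i ⊎ x ≡ j → ∀ xs → All (x ≢_) xs → T (allDistinct xs) →
      inversions (map σ (x ∷ xs)) ≤ suc (inversions (x ∷ xs))
    inversions-σ-moved {x} moved xs x∉xs d = begin
      countLess (σ x) (map σ xs) + inversions (map σ xs)
        ≡⟨ cong (countLess (σ x) (map σ xs) +_) (inversions-σ-avoiding moved x∉xs) ⟩
      countLess (σ x) (map σ xs) + inversions xs  ≤⟨ +-monoˡ-≤ (inversions xs) (countLess-σ x xs d) ⟩
      suc (countLess x xs + inversions xs)        ∎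
      where open ≤-Reasoning

    inversions-σ : ∀ xs → T (allDistinct xs) → inversions (map σ xs) ≤ suc (inversions xs)
    inversions-σ []       _ = z≤n
    inversions-σ (x ∷ xs) d with distinct-∷ x xs d | position x
    ... | x∉xs , d′ | at-i x≡i = inversions-σ-moved (inj₁ x≡i) xs x∉xs d′
    ... | x∉xs , d′ | at-j x≡j = inversions-σ-moved (inj₂ x≡j) xs x∉xs d′
    ... | _ , d′    | elsewhere x≢i x≢j = begin
      countLess (σ x) (map σ xs) + inversions (map σ xs)
        ≡⟨ cong (_+ inversions (map σ xs)) (countLess-σ-unswapped x (All.universal unswapped xs)) ⟩
      countLess x xs + inversions (map σ xs)      ≤⟨ +-monoʳ-≤ (countLess x xs) (inversions-σ xs d′) ⟩
      countLess x xs + suc (inversions xs)        ≡⟨ +-suc (countLess x xs) _ ⟩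
      suc (countLess x xs + inversions xs)        ∎
      where
      open ≤-Reasoning
      unswapped : ∀ z → ¬ Swapped x z
      unswapped z (inj₁ (x≡i , _)) = x≢i x≡i
      unswapped z (inj₂ (x≡j , _)) = x≢j x≡j

  module _ {n} (s : S n) where
    open Transposition s

    act-involutive : ∀ w → act s (act s w) ≡ w
    act-involutive (v , _) =
      W-≡ (trans (sym (map-∘ σ σ v)) (trans (map-cong σ-involutive v) (map-id v)))

    act-≟W : ∀ x y → does (act s x ≟W y) ≡ does (x ≟W act s y)
    act-≟W x y = does-⇔
      (mk⇔ (λ sx≡y → trans (sym (act-involutive x)) (cong (act s) sx≡y))
           (λ x≡sy → trans (cong (act s) x≡sy) (act-involutive y)))
      (act s x ≟W y) (x ≟W act s y)

    len-act : ∀ w → len (act s w) ≤ suc (len w)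
    len-act (v , v-perm) rewrite toList-map σ v = inversions-σ (toList v) v-perm

  len-bound : ∀ {n} (w : W n) → len w ≤ n * n
  len-bound {n} (v , _) = subst (λ m → inversions (toList v) ≤ m * m) (length-toList v) (bound (toList v))
    where
    countLess-≤ : ∀ x ys → countLess x ys ≤ length ys
    countLess-≤ x []       = z≤n
    countLess-≤ x (y ∷ ys) with toℕ y <ᵇ toℕ x
    ... | true  = s≤s (countLess-≤ x ys)
    ... | false = m≤n⇒m≤1+n (countLess-≤ x ys)
    bound : ∀ xs → inversions xs ≤ length xs * length xs
    bound []       = z≤n
    bound (x ∷ xs) = ≤-trans (+-mono-≤ (countLess-≤ x xs) (≤-trans (bound xs) (*-monoʳ-≤ (length xs) (n≤1+n _))))
                             (n≤1+n _)

  module _ {n} (w : W n) where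

    search-lowers : (search : List (S n) → Maybe (S n)) → search [] ≡ nothing →
      (∀ s ss → search (s ∷ ss) ≡ (if len (act s w) <ᵇ len w then just s else search ss)) →
      ∀ ss {s} → search ss ≡ just s → len (act s w) < len w
    search-lowers search search-[] search-∷ [] eq with () ← trans (sym search-[]) eq
    search-lowers search search-[] search-∷ (s′ ∷ ss) {s} eq =
      by-cases _ refl (trans (sym (search-∷ s′ ss)) eq)
      where
      by-cases : ∀ b → b ≡ (len (act s′ w) <ᵇ len w) →
        (if b then just s′ else search ss) ≡ just s → len (act s w) < len w
      by-cases true  lowers refl = <ᵇ⇒< _ _ (subst T lowers _)
      by-cases false _      found = search-lowers search search-[] search-∷ ss found

  -- descent runs a search local to its definition; once allS n is abstracted,
  -- unification solves `search` as that local function.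
  descent-lowers : ∀ {n} (w : W n) {s} → descent w ≡ just s → len (act s w) < len w
  descent-lowers {n} w = lowers
    where
    search : List (S n) → Maybe (S n)
    search = _
    lowers : ∀ {s} → descent w ≡ just s → len (act s w) < len w
    lowers with allS n
    ... | ss = search-lowers w search refl (λ _ _ → refl) ss

module Hecke where

  open Laurent
  open Permutation
  open MeasureInduction
  open import Data.Bool using (true; false)
  open import Data.List using (_++_; map; concat)
  open import Data.List.Properties using (map-∘; ++-identityʳ)
  open import Data.Maybe using (just; nothing)
  open import Data.Nat using (zero; suc; _≤_; _<_; _<ᵇ_)
  import Data.Nat.Properties as ℕ
  open import Data.Product using (proj₁; proj₂)
  open import Data.Sum using (_⊎_; inj₁; inj₂)
  open import Relation.Binary.PropositionalEquality as ≡ using (_≡_; _≢_)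
  open import Relation.Nullary using (yes; no)

  module HSum {n} = FormalSum Laurent (_≟W_ {n}) coeffH (λ _ → coeffwise λ _ → ≡.refl)
                      (λ _ _ _ _ → coeffwise λ _ → ≡.refl)
  open HSum

  open Ring Laurent
  open import Algebra.Properties.CommutativeSemigroup +-commutativeSemigroup using (interchange)
  open import Algebra.Properties.Group +-group using (x∙y⁻¹≈ε⇒x≈y)
  open import Relation.Binary.Reasoning.Setoid setoid

  v-v⁻¹ : L
  v-v⁻¹ = vL +L (-L v⁻¹L)

  descentFactor : ∀ {n} → S n → W n → L
  descentFactor s y = if len y <ᵇ len (act s y) then 0L else v-v⁻¹

  TsMul-∷ : ∀ {n} (s : S n) t h → TsMul s (t ∷ h) ≡ TsMul s (t ∷ []) ++ TsMul s h
  TsMul-∷ s t h = ≡.cong (_++ TsMul s h) (≡.sym (++-identityʳ _))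

  coeffH-monomial : ∀ {n} a (w y : W n) → coeffH ((a , w) ∷ []) y ≈ a * δ w y
  coeffH-monomial a w y = trans (coeff-as-pairing ((a , w) ∷ []) y) (+-identityʳ _)

  coeffH-TsMul-monomial : ∀ {n} (s : S n) a w y →
    coeffH (TsMul s ((a , w) ∷ [])) y ≈ a * δ w (act s y) + (a * δ w y) * descentFactor s y
  coeffH-TsMul-monomial s a w y with len w <ᵇ len (act s w) in cw
  ... | true = begin
    coeffH ((a , act s w) ∷ []) y                            ≈⟨ coeffH-monomial a (act s w) y ⟩
    a * δ (act s w) y                                        ≡⟨ ≡.cong (λ b → a * (if b then 1L else 0L)) (act-≟W s w y) ⟩
    a * δ w (act s y)                                        ≈⟨ +-identityʳ (a * δ w (act s y)) ⟨
    a * δ w (act s y) + 0L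
      ≈⟨ +-congˡ {a * δ w (act s y)} (trans (*-assoc a (δ w y) (descentFactor s y)) (trans (*-congˡ {a} transported) (zeroʳ a))) ⟨
    a * δ w (act s y) + (a * δ w y) * descentFactor s y      ∎
    where
    transported : δ w y * descentFactor s y ≈ 0L
    transported = begin
      δ w y * descentFactor s y                              ≈⟨ δ-transport w y (descentFactor s) ⟩
      δ w y * descentFactor s w                              ≡⟨ ≡.cong (λ b → δ w y * (if b then 0L else v-v⁻¹)) cw ⟩
      δ w y * 0L                                             ≈⟨ zeroʳ (δ w y) ⟩
      0L                                                     ∎
  ... | false = begin
    coeffH ((a , act s w) ∷ (a * v-v⁻¹ , w) ∷ []) y           ≈⟨ coeff-++ ((a , act s w) ∷ []) ((a * v-v⁻¹ , w) ∷ []) y ⟩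
    coeffH ((a , act s w) ∷ []) y + coeffH ((a * v-v⁻¹ , w) ∷ []) y
                                                             ≈⟨ +-cong (coeffH-monomial a (act s w) y) (coeffH-monomial (a * v-v⁻¹) w y) ⟩
    a * δ (act s w) y + (a * v-v⁻¹) * δ w y                  ≡⟨ ≡.cong (λ b → a * (if b then 1L else 0L) + (a * v-v⁻¹) * δ w y) (act-≟W s w y) ⟩
    a * δ w (act s y) + (a * v-v⁻¹) * δ w y
      ≈⟨ +-congˡ {a * δ w (act s y)} (trans (*-assoc a (δ w y) (descentFactor s y))
                                            (trans (*-congˡ {a} transported) (sym (*-assoc a v-v⁻¹ (δ w y))))) ⟨
    a * δ w (act s y) + (a * δ w y) * descentFactor s y      ∎
    where
    transported : δ w y * descentFactor s y ≈ v-v⁻¹ * δ w y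
    transported = begin
      δ w y * descentFactor s y                              ≈⟨ δ-transport w y (descentFactor s) ⟩
      δ w y * descentFactor s w                              ≡⟨ ≡.cong (λ b → δ w y * (if b then 0L else v-v⁻¹)) cw ⟩
      δ w y * v-v⁻¹                                          ≈⟨ δ-central w y v-v⁻¹ ⟩
      v-v⁻¹ * δ w y                                          ∎

  coeffH-TsMul : ∀ {n} (s : S n) h y →
    coeffH (TsMul s h) y ≈ coeffH h (act s y) + coeffH h y * descentFactor s y
  coeffH-TsMul s [] y = sym (trans (+-identityˡ (0L * descentFactor s y)) (zeroˡ (descentFactor s y)))
  coeffH-TsMul s ((a , w) ∷ h) y = begin
    coeffH (TsMul s ((a , w) ∷ h)) y
      ≡⟨ ≡.cong (λ l → coeffH l y) (TsMul-∷ s (a , w) h) ⟩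
    coeffH (TsMul s ((a , w) ∷ []) ++ TsMul s h) y
      ≈⟨ coeff-++ (TsMul s ((a , w) ∷ [])) (TsMul s h) y ⟩
    coeffH (TsMul s ((a , w) ∷ [])) y + coeffH (TsMul s h) y
      ≈⟨ +-cong (coeffH-TsMul-monomial s a w y) (coeffH-TsMul s h y) ⟩
    (a * δ w (act s y) + (a * δ w y) * χ) + (coeffH h (act s y) + coeffH h y * χ)
      ≈⟨ interchange (a * δ w (act s y)) _ (coeffH h (act s y)) _ ⟩
    (a * δ w (act s y) + coeffH h (act s y)) + ((a * δ w y) * χ + coeffH h y * χ)
      ≈⟨ +-cong (+-congʳ (coeffH-monomial a w (act s y))) (distribʳ χ (a * δ w y) (coeffH h y)) ⟨
    (coeffH ((a , w) ∷ []) (act s y) + coeffH h (act s y)) + (a * δ w y + coeffH h y) * χ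
      ≈⟨ +-cong (coeff-++ ((a , w) ∷ []) h (act s y))
                (*-congʳ {χ} (trans (coeff-++ ((a , w) ∷ []) h y) (+-congʳ (coeffH-monomial a w y)))) ⟨
    coeffH ((a , w) ∷ h) (act s y) + coeffH ((a , w) ∷ h) y * χ
      ∎
    where
    χ : L
    χ = descentFactor s y

  coeffH-TsInvMul : ∀ {n} (s : S n) h y → coeffH h y ≈ 0L → coeffH (TsInvMul s h) y ≈ coeffH h (act s y)
  coeffH-TsInvMul s h y h-y≈0 = begin
    coeffH (TsMul s h ++ (-L v-v⁻¹) • h) y
      ≈⟨ coeff-++ (TsMul s h) ((-L v-v⁻¹) • h) y ⟩
    coeffH (TsMul s h) y + coeffH ((-L v-v⁻¹) • h) y
      ≈⟨ +-cong (coeffH-TsMul s h y) (coeff-• (-L v-v⁻¹) h y) ⟩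
    (coeffH h (act s y) + coeffH h y * descentFactor s y) + (-L v-v⁻¹) * coeffH h y
      ≈⟨ +-cong (+-congˡ {coeffH h (act s y)} (trans (*-congʳ {descentFactor s y} h-y≈0) (zeroˡ (descentFactor s y))))
                (trans (*-congˡ { -L v-v⁻¹} h-y≈0) (zeroʳ (-L v-v⁻¹))) ⟩
    (coeffH h (act s y) + 0L) + 0L
      ≈⟨ trans (+-identityʳ _) (+-identityʳ _) ⟩
    coeffH h (act s y)
      ∎

  len-<⇒≢ : ∀ {n} {x y : W n} → len x < len y → x ≢ y
  len-<⇒≢ lx<ly ≡.refl = ℕ.<-irrefl ≡.refl lx<ly

  barT′-unitriangular : ∀ {n} k (w y : W n) → len w ≤ len y → coeffH (barT′ k w) y ≈ δ w y
  barT′-unitriangular zero    w y _ = coeff-T w y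
  barT′-unitriangular (suc k) w y lw≤ly with descent w in found
  ... | nothing = coeff-T w y
  ... | just s  = begin
    coeffH (TsInvMul s (barT′ k (act s w))) y  ≈⟨ coeffH-TsInvMul s (barT′ k (act s w)) y vanishes-at-y ⟩
    coeffH (barT′ k (act s w)) (act s y)       ≈⟨ barT′-unitriangular k (act s w) (act s y) lsw≤lsy ⟩
    δ (act s w) (act s y)                      ≡⟨ ≡.cong (λ b → if b then 1L else 0L) act-act ⟩
    δ w y                                      ∎
    where
    lsw<ly : len (act s w) < len y
    lsw<ly = ℕ.<-≤-trans (descent-lowers w found) lw≤ly
    vanishes-at-y : coeffH (barT′ k (act s w)) y ≈ 0L
    vanishes-at-y = trans (barT′-unitriangular k (act s w) y (ℕ.<⇒≤ lsw<ly)) (δ-≢ (len-<⇒≢ {x = act s w} {y} lsw<ly))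
    lsw≤lsy : len (act s w) ≤ len (act s y)
    lsw≤lsy = ℕ.≤-pred (ℕ.<-≤-trans lsw<ly
                (≡.subst (λ z → len z ≤ suc (len (act s y))) (act-involutive s y) (len-act s (act s y))))
    act-act : does (act s w ≟W act s y) ≡ does (w ≟W y)
    act-act = ≡.trans (act-≟W s w (act s y)) (≡.cong (λ z → does (w ≟W z)) (act-involutive s y))

  barCoeffs : ∀ {n} → H n → H n
  barCoeffs = map (λ t → (barL (proj₁ t) , proj₂ t))

  coeffH-barCoeffs : ∀ {n} (h : H n) w → coeffH (barCoeffs h) w ≡ barL (coeffH h w)
  coeffH-barCoeffs []            w = ≡.refl
  coeffH-barCoeffs ((a , x) ∷ h) w = ≡.trans
    (≡.cong₂ _++_ (bar-if (x ==W w)) (coeffH-barCoeffs h w))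
    (≡.sym (barL-++ (if x ==W w then a else 0L) (coeffH h w)))
    where
    bar-if : ∀ b → (if b then barL a else 0L) ≡ barL (if b then a else 0L)
    bar-if true  = ≡.refl
    bar-if false = ≡.refl

  coeffH-barH : ∀ {n} (h : H n) y → coeffH (barH h) y ≈ ⟨ barCoeffs h , (λ w → coeffH (barT w) y) ⟩
  coeffH-barH h y = begin
    coeffH (barH h) y                               ≡⟨ ≡.cong (λ l → coeffH (concat l) y) (map-∘ h) ⟩
    coeffH (combination barT (barCoeffs h)) y       ≈⟨ coeff-combination barT (barCoeffs h) y ⟩
    ⟨ barCoeffs h , (λ w → coeffH (barT w) y) ⟩     ∎

  module _ {n} {C : W n → H n} (C-KL : IsKLBasis C) where

    coeffH-C-bar-invariant : ∀ x y → (∀ w → len y < len w → coeffH (C x) w ≈ 0L) →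
      barL (coeffH (C x) y) ≈ coeffH (C x) y
    coeffH-C-bar-invariant x y above-y-vanishes = begin
      barL (coeffH (C x) y)                               ≡⟨ coeffH-barCoeffs (C x) y ⟨
      coeffH (barCoeffs (C x)) y                          ≈⟨ coeff-as-pairing (barCoeffs (C x)) y ⟩
      ⟨ barCoeffs (C x) , (λ w → δ w y) ⟩                 ≈⟨ ⟨⟩-cong-on-support (barCoeffs (C x)) support ⟨
      ⟨ barCoeffs (C x) , (λ w → coeffH (barT w) y) ⟩     ≈⟨ coeffH-barH (C x) y ⟨
      coeffH (barH (C x)) y                               ≈⟨ coeffwise (proj₁ C-KL x y) ⟩
      coeffH (C x) y                                      ∎
      where
      support : ∀ w → coeffH (barCoeffs (C x)) w ≈ 0L ⊎ coeffH (barT w) y ≈ δ w y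
      support w with len w ℕ.≤? len y
      ... | yes lw≤ly = inj₂ (barT′-unitriangular (len w) w y lw≤ly)
      ... | no  lw≰ly = inj₁ (trans (reflexive (coeffH-barCoeffs (C x) w))
                                     (coeffwise (barL-cong (coeffH (C x) w) 0L (coeffs (above-y-vanishes w (ℕ.≰⇒> lw≰ly))))))

    coeffH-C-step : ∀ x y → (∀ w → len y < len w → coeffH (C x) w ≈ 0L) → coeffH (C x) y ≈ δ x y
    coeffH-C-step x y above-y-vanishes = x∙y⁻¹≈ε⇒x≈y c (δ x y) (begin
      c + -L δ x y     ≈⟨ +-congˡ {c} d≈-δ ⟨
      c + d            ≈⟨ coeff-++ (C x) (-H Tb x) y ⟨
      p                ≈⟨ coeffwise (bar-invariant∧InVZv⇒0 {p} (coeffs p-bar-invariant) (proj₂ C-KL x y)) ⟩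
      0L               ∎)
      where
      c d p : L
      c = coeffH (C x) y
      d = coeffH (-H Tb x) y
      p = coeffH (C x ++ -H Tb x) y
      d≈-δ : d ≈ -L δ x y
      d≈-δ with x ==W y
      ... | true  = coeffwise λ _ → ≡.refl
      ... | false = coeffwise λ _ → ≡.refl
      d-bar-invariant : barL d ≡ d
      d-bar-invariant with x ==W y
      ... | true  = ≡.refl
      ... | false = ≡.refl
      p-bar-invariant : barL p ≈ p
      p-bar-invariant = begin
        barL p                 ≈⟨ coeffwise (barL-cong p (c ++ d) (coeffs (coeff-++ (C x) (-H Tb x) y))) ⟩
        barL (c ++ d)          ≡⟨ barL-++ c d ⟩
        barL c ++ barL d       ≈⟨ +-cong (coeffH-C-bar-invariant x y above-y-vanishes) (reflexive d-bar-invariant) ⟩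
        c ++ d                 ≈⟨ coeff-++ (C x) (-H Tb x) y ⟨
        p                      ∎

    C-unitriangular : Unitriangular len C
    C-unitriangular x = downward-induction len (λ y → len x ≤ len y → coeffH (C x) y ≈ δ x y) len-bound step
      where
      step : ∀ y → (∀ w → len y < len w → len x ≤ len w → coeffH (C x) w ≈ δ x w) →
        len x ≤ len y → coeffH (C x) y ≈ δ x y
      step y ih lx≤ly = coeffH-C-step x y λ w ly<lw →
        let lx<lw = ℕ.≤-<-trans lx≤ly ly<lw in
        trans (ih w ly<lw (ℕ.<⇒≤ lx<lw)) (δ-≢ (len-<⇒≢ {x = x} {w} lx<lw))

  quotBasis : ∀ {n} (U : W n → Bool) (C : W n → H n) → IsKLBasis C → QuotBasis U C
  quotBasis U C C-KL with unitriangular⇒quotientBasis len len-bound (C-unitriangular {C = C} C-KL) U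
  ... | decompose , independent =
    (λ h → let as , bs , as∉U , bs∈U , h≈ = decompose h in as , bs , as∉U , bs∈U , λ w → coeffs (h≈ w)) ,
    (λ as bs as∉U bs∈U as≈ w → coeffs (independent as bs as∉U bs∈U (λ w → coeffwise (as≈ w)) w))

module Specialization {c ℓ} (R : CommutativeRing c ℓ) where

  open Laurent using (ev1-++; ev1-cong; coeffs)
  open Permutation using (_≟W_; len-bound)
  open Hecke using (C-unitriangular)
  open import Data.Bool using (true; false)
  open import Data.Integer as ℤ using (ℤ; +_; -[1+_]; _⊖_)
  import Data.Integer.Properties as ℤ
  open import Data.Nat as ℕ using (zero; suc)
  import Data.Nat.Properties as ℕ
  open import Function using (_∘_)
  open import Relation.Binary.PropositionalEquality as ≡ using (_≡_)

  open CommutativeRing R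
  open Spec R
  open import Algebra.Properties.Ring ring using (-‿+-comm; -0#≈0#)
  open import Algebra.Properties.CommutativeSemigroup +-commutativeSemigroup using (interchange)
  open import Relation.Binary.Reasoning.Setoid setoid

  module KSum {n} = FormalSum ring (_≟W_ {n}) coeffK (λ _ → refl) (λ _ _ _ _ → refl)
  open KSum

  natK-homo-+ : ∀ m k → natK (m ℕ.+ k) ≈ natK m + natK k
  natK-homo-+ zero    k = sym (+-identityˡ _)
  natK-homo-+ (suc m) k = trans (+-congˡ (natK-homo-+ m k)) (sym (+-assoc 1# (natK m) (natK k)))

  intK-⊖ : ∀ m k → intK (m ⊖ k) ≈ natK m + - natK k
  intK-⊖ zero    zero    = sym (trans (+-congˡ -0#≈0#) (+-identityʳ 0#))
  intK-⊖ (suc m) zero    = sym (trans (+-congˡ -0#≈0#) (+-identityʳ _))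
  intK-⊖ zero    (suc k) = sym (+-identityˡ _)
  intK-⊖ (suc m) (suc k) = begin
    intK (suc m ⊖ suc k)                       ≡⟨ ≡.cong intK (ℤ.[1+m]⊖[1+n]≡m⊖n m k) ⟩
    intK (m ⊖ k)                               ≈⟨ intK-⊖ m k ⟩
    natK m + - natK k                          ≈⟨ +-identityˡ _ ⟨
    0# + (natK m + - natK k)                   ≈⟨ +-congʳ (-‿inverseʳ 1#) ⟨
    (1# + - 1#) + (natK m + - natK k)          ≈⟨ interchange 1# (- 1#) (natK m) (- natK k) ⟩
    (1# + natK m) + (- 1# + - natK k)          ≈⟨ +-congˡ (-‿+-comm 1# (natK k)) ⟩
    natK (suc m) + - natK (suc k)              ∎

  intK-homo-+ : ∀ a b → intK (a ℤ.+ b) ≈ intK a + intK b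
  intK-homo-+ (+ m)    (+ k)    = natK-homo-+ m k
  intK-homo-+ (+ m)    -[1+ k ] = intK-⊖ m (suc k)
  intK-homo-+ -[1+ m ] (+ k)    = trans (intK-⊖ k (suc m)) (+-comm _ _)
  intK-homo-+ -[1+ m ] -[1+ k ] = begin
    - natK (suc (suc (m ℕ.+ k)))               ≡⟨ ≡.cong (λ z → - natK z) (≡.sym (ℕ.+-suc (suc m) k)) ⟩
    - natK (suc m ℕ.+ suc k)                   ≈⟨ -‿cong (natK-homo-+ (suc m) (suc k)) ⟩
    - (natK (suc m) + natK (suc k))            ≈⟨ -‿+-comm _ _ ⟨
    - natK (suc m) + - natK (suc k)            ∎

  coeffK-spec : ∀ {n} (h : H n) y → coeffK (spec h) y ≈ intK (ev1 (coeffH h y))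
  coeffK-spec []            y = refl
  coeffK-spec ((a , z) ∷ h) y = begin
    (if z ==W y then intK (ev1 a) else 0#) + coeffK (spec h) y
      ≈⟨ +-cong (reflexive (specialise-if (z ==W y))) (coeffK-spec h y) ⟩
    intK (ev1 (if z ==W y then a else 0L)) + intK (ev1 (coeffH h y))
      ≈⟨ intK-homo-+ (ev1 (if z ==W y then a else 0L)) (ev1 (coeffH h y)) ⟨
    intK (ev1 (if z ==W y then a else 0L) ℤ.+ ev1 (coeffH h y))
      ≡⟨ ≡.cong intK (ev1-++ (if z ==W y then a else 0L) (coeffH h y)) ⟨
    intK (ev1 ((if z ==W y then a else 0L) +L coeffH h y))
      ∎
    where
    specialise-if : ∀ b → (if b then intK (ev1 a) else 0#) ≡ intK (ev1 (if b then a else 0L))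
    specialise-if true  = ≡.refl
    specialise-if false = ≡.refl

  spec-C-unitriangular : ∀ {n} {C : W n → H n} → IsKLBasis C → Unitriangular len (spec ∘ C)
  spec-C-unitriangular {C = C} C-KL x y lx≤ly = begin
    coeffK (spec (C x)) y            ≈⟨ coeffK-spec (C x) y ⟩
    intK (ev1 (coeffH (C x) y))      ≡⟨ ≡.cong intK (ev1-cong (coeffH (C x) y) (Hecke.HSum.δ x y) (coeffs (C-unitriangular {C = C} C-KL x y lx≤ly))) ⟩
    intK (ev1 (Hecke.HSum.δ x y))    ≈⟨ specialise-δ (does (x ≟W y)) ⟩
    δ x y                            ∎
    where
    specialise-δ : ∀ b → intK (ev1 (if b then 1L else 0L)) ≈ (if b then 1# else 0#)
    specialise-δ true  = +-identityʳ 1#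
    specialise-δ false = refl

  quotBasisK : ∀ {n} (U : W n → Bool) (C : W n → H n) → IsKLBasis C → QuotBasisK U C
  quotBasisK U C C-KL = unitriangular⇒quotientBasis len len-bound (spec-C-unitriangular {C = C} C-KL) U

mainTheorem7 : ∀ {c ℓ : Level} (n : ℕ) (U : W n → Bool) (C : W n → H n) →
    IsKLBasis C →
    QuotBasis U C × ((R : CommutativeRing c ℓ) → Spec.QuotBasisK R U C)
mainTheorem7 n U C C-KL = Hecke.quotBasis U C C-KL , λ R → Specialization.quotBasisK R U C C-KL
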